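{- Let $r,c,v\ge 2$ be integers with associated numbers $e,\lambda_{rc},\lambda_{rr},\lambda_{cc},\mu$ as in the context, and let \[ S_{\mathrm{NTA}} := S\Big(\binom{c}{2}, \lambda_{cc}\Big) + S\Big(\binom{r}{2}, \lambda_{rr}\Big) + S(rc, \lambda_{rc}),\qquad S_{\mathrm{NBG}} := S\Big(\binom{v}{2}, \mu\Big). \] Suppose that $\mu$ is an integer, $e$ is not an integer, and $S_{\mathrm{NTA}}=S_{\mathrm{NBG}}$. Then there is no $(r\times c,v)$-near triple array.
   Context: For real $x$ write $x^-=\lfloor x\rfloor$, $x^+=\lceil x\rceil$, $\binom{x}{2}=x(x-1)/2$. For an integer $n$ and real $m$, $S(n,m) := n\binom{m}{2} + \frac{n(m-m^-)(m^+-m)}{2}$. Parameters of $(r\times c,v)$: $e=rc/v$, $\lambda_{rc}= e^-+e^+-\frac{e^-e^+}{e}$, $\lambda_{rr}=\frac{c(\lambda_{rc}-1)}{r-1}$, $\lambda_{cc}=\frac{r(\lambda_{rc}-1)}{c-1}$, $\mu=\frac{\binom{c}{2}r+\binom{r}{2}c}{\binom{v}{2}}$. An $r\times c$ row-column design on $v$ symbols is an $r\times c$ array each of whose cells holds one of $v$ symbols; it is binary if no symbol occurs twice in a row or in a column; equireplicate if $e$ is an integer and each symbol occurs exactly $e$ times; near equireplicate if $e$ is not an integer and each symbol occurs $e^-$ or $e^+$ times. For a binary design, with $R_i$, $C_j$ the symbol sets of row $i$ and column $j$, let $\bar\lambda_{rc}$, $\bar\lambda_{rr}$, $\bar\lambda_{cc}$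 be the averages of $|R_i\cap C_j|$ over all row–column pairs, of $|R_i\cap R_j|$ over pairs of distinct rows, and of $|C_i\cap C_j|$ over pairs of distinct columns. An $(r\times c,v)$-near triple array is a binary equireplicate or near equireplicate $r\times c$ design on $v$ symbols in which every row and column share $\bar\lambda_{rc}^-$ or $\bar\lambda_{rc}^+$ symbols, every two distinct rows share $\bar\lambda_{rr}^-$ or $\bar\lambda_{rr}^+$ symbols, and every two distinct columns share $\bar\lambda_{cc}^-$ or $\bar\lambda_{cc}^+$ symbols. -}

module Defs where

open import Data.Nat as ℕ using (ℕ; zero; suc)
open import Data.Integer as ℤ using (ℤ; +_; -[1+_])
open import Data.Rational as ℚ using (ℚ; mkℚ; 0ℚ; 1ℚ; _/_; floor; ceiling; 1/_)
open import Data.Fin using (Fin; zero; suc)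
open import Data.Fin.Properties using (any?)
open import Data.Product using (Σ; _×_; _,_; ∃)
open import Data.Sum using (_⊎_)
open import Relation.Nullary using (¬_; Dec; yes; no)
open import Relation.Binary.PropositionalEquality using (_≡_; _≢_)

ι : ℤ → ℚ
ι z = z / 1

ℕ→ℚ : ℕ → ℚ
ℕ→ℚ n = + n / 1

_⁻ : ℚ → ℚ
x ⁻ = ι (floor x)

_⁺ : ℚ → ℚ
x ⁺ = ι (ceiling x)

-- total inverse (1/0 := 0); only ever applied to nonzero values below
inv : ℚ → ℚ
inv (mkℚ (+ zero) _ _) = 0ℚ
inv p@(mkℚ (+ suc n) _ _) = 1/ p
inv p@(mkℚ -[1+ n ] _ _) = 1/ p

_÷_ : ℚ → ℚ → ℚ
p ÷ q = p ℚ.* inv q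

choose2 : ℚ → ℚ
choose2 x = (x ℚ.* (x ℚ.- 1ℚ)) ÷ ℕ→ℚ 2

ch2 : ℕ → ℕ
ch2 n = (n ℕ.* (n ℕ.∸ 1)) ℕ./ 2

IsInteger : ℚ → Set
IsInteger x = Σ ℤ λ z → x ≡ ι z

S : ℕ → ℚ → ℚ
S n m = (ℕ→ℚ n ℚ.* choose2 m)
        ℚ.+ ((ℕ→ℚ n ℚ.* (m ℚ.- m ⁻) ℚ.* (m ⁺ ℚ.- m)) ÷ ℕ→ℚ 2)

e : ℕ → ℕ → ℕ → ℚ
e r c v = ℕ→ℚ (r ℕ.* c) ÷ ℕ→ℚ v

λrc : ℕ → ℕ → ℕ → ℚ
λrc r c v = (e r c v ⁻ ℚ.+ e r c v ⁺) ℚ.- ((e r c v ⁻ ℚ.* e r c v ⁺) ÷ e r c v)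

λrr : ℕ → ℕ → ℕ → ℚ
λrr r c v = (ℕ→ℚ c ℚ.* (λrc r c v ℚ.- 1ℚ)) ÷ ℕ→ℚ (r ℕ.∸ 1)

λcc : ℕ → ℕ → ℕ → ℚ
λcc r c v = (ℕ→ℚ r ℚ.* (λrc r c v ℚ.- 1ℚ)) ÷ ℕ→ℚ (c ℕ.∸ 1)

μ : ℕ → ℕ → ℕ → ℚ
μ r c v = ℕ→ℚ ((ch2 c ℕ.* r) ℕ.+ (ch2 r ℕ.* c)) ÷ ℕ→ℚ (ch2 v)

S-NTA : ℕ → ℕ → ℕ → ℚ
S-NTA r c v = (S (ch2 c) (λcc r c v) ℚ.+ S (ch2 r) (λrr r c v)) ℚ.+ S (r ℕ.* c) (λrc r c v)

S-NBG : ℕ → ℕ → ℕ → ℚ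
S-NBG r c v = S (ch2 v) (μ r c v)

sumFin : ∀ {n} → (Fin n → ℕ) → ℕ
sumFin {zero} f = 0
sumFin {suc n} f = f zero ℕ.+ sumFin (λ i → f (suc i))

count : ∀ {n} {P : Fin n → Set} → ((i : Fin n) → Dec (P i)) → ℕ
count P? = sumFin (λ i → indicator (P? i))
  where
  indicator : ∀ {A : Set} → Dec A → ℕ
  indicator (yes _) = 1
  indicator (no _) = 0

Design : ℕ → ℕ → ℕ → Set
Design r c v = Fin r → Fin c → Fin v

module _ {r c v : ℕ} (A : Design r c v) where

  Binary : Set
  Binary = (∀ i j j′ → j ≢ j′ → A i j ≢ A i j′)
         × (∀ j i i′ → i ≢ i′ → A i j ≢ A i′ j)

  replication : Fin v → ℕ
  replication s = sumFin λ i → count (λ j → A i j Data.Fin.≟ s)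

  InRow : Fin r → Fin v → Set
  InRow i s = ∃ λ j → A i j ≡ s

  InCol : Fin c → Fin v → Set
  InCol j s = ∃ λ i → A i j ≡ s

  inRow? : ∀ i s → Dec (InRow i s)
  inRow? i s = any? (λ j → A i j Data.Fin.≟ s)

  inCol? : ∀ j s → Dec (InCol j s)
  inCol? j s = any? (λ i → A i j Data.Fin.≟ s)

  both? : {P Q : Set} → Dec P → Dec Q → Dec (P × Q)
  both? (yes p) (yes q) = yes (p , q)
  both? (yes p) (no ¬q) = no λ { (_ , q) → ¬q q }
  both? (no ¬p) _ = no λ { (p , _) → ¬p p }

  rc∩ : Fin r → Fin c → ℕ
  rc∩ i j = count λ s → both? (inRow? i s) (inCol? j s)

  rr∩ : Fin r → Fin r → ℕ
  rr∩ i i′ = count λ s → both? (inRow? i s) (inRow? i′ s)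

  cc∩ : Fin c → Fin c → ℕ
  cc∩ j j′ = count λ s → both? (inCol? j s) (inCol? j′ s)

  -- sums over ordered pairs of distinct indices (each unordered pair twice)
  sumDistinct : ∀ {n} → (Fin n → Fin n → ℕ) → ℕ
  sumDistinct {n} f = sumFin λ i → sumFin λ i′ → g i i′ (i Data.Fin.≟ i′)
    where
    g : Fin n → Fin n → {P : Set} → Dec P → ℕ
    g i i′ (yes _) = 0
    g i i′ (no _) = f i i′

  avg-rc : ℚ
  avg-rc = ℕ→ℚ (sumFin λ i → sumFin λ j → rc∩ i j) ÷ ℕ→ℚ (r ℕ.* c)

  avg-rr : ℚ
  avg-rr = ℕ→ℚ (sumDistinct rr∩) ÷ ℕ→ℚ (r ℕ.* (r ℕ.∸ 1))

  avg-cc : ℚ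
  avg-cc = ℕ→ℚ (sumDistinct cc∩) ÷ ℕ→ℚ (c ℕ.* (c ℕ.∸ 1))

  FloorOrCeil : ℕ → ℚ → Set
  FloorOrCeil n x = (ℕ→ℚ n ≡ x ⁻) ⊎ (ℕ→ℚ n ≡ x ⁺)

  Equireplicate : Set
  Equireplicate = IsInteger (e r c v) × (∀ s → ℕ→ℚ (replication s) ≡ e r c v)

  NearEquireplicate : Set
  NearEquireplicate = (¬ IsInteger (e r c v))
                    × (∀ s → FloorOrCeil (replication s) (e r c v))

  IsNearTripleArray : Set
  IsNearTripleArray =
      Binary
    × (Equireplicate ⊎ NearEquireplicate)
    × (∀ i j → FloorOrCeil (rc∩ i j) avg-rc)
    × (∀ i i′ → i ≢ i′ → FloorOrCeil (rr∩ i i′) avg-rr)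
    × (∀ j j′ → j ≢ j′ → FloorOrCeil (cc∩ j j′) avg-cc)

{-# OPTIONS --safe #-}
module Submission where

-- For symbols s ≠ t let λ(s,t) be the number of rows plus the number of columns containing
-- both (their concurrence). Counting incidences in two ways gives
--   Σ_{s≠t} λ(λ−1) = Σ_{i≠i′} |Rᵢ∩Rᵢ′|(|Rᵢ∩Rᵢ′|−1) + Σ_{j≠j′} |Cⱼ∩Cⱼ′|(|Cⱼ∩Cⱼ′|−1)
--                    + 2 Σ_{i,j} |Rᵢ∩Cⱼ|(|Rᵢ∩Cⱼ|−1)
-- and Σ_{s≠t} λ = v(v−1)μ. In a near triple array every intersection size is the floor or the
-- ceiling of its average, and these averages are λrc, λrr and λcc (near-equireplication gives
-- Σ_s e_s² = rc·λrc). A family of n naturals with values in {⌊m⌋, ⌈m⌉} and mean m has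
-- Σ x(x−1) = 2 S(n,m), so the right-hand side above is 4 S_NTA, while 4 S_NBG = v(v−1)μ(μ−1)
-- when μ is an integer. Hence S_NTA = S_NBG says that the concurrences have mean μ and
-- variance 0, i.e. all of them equal μ. Counting the pairs through a fixed symbol s then gives
-- e_s (r + c − 2) = (v − 1) μ, so all replications are equal and e = rc/v is an integer.

open import Defs
open import Data.Nat using (ℕ; zero; suc; _≥_)
open import Data.Product using (Σ; _,_; _×_; proj₁; proj₂)
open import Relation.Nullary using (¬_; Dec; yes; no)
open import Relation.Binary.PropositionalEquality
  using (_≡_; _≢_; refl; sym; trans; cong; cong₂; subst; subst₂; module ≡-Reasoning)

open import Data.Empty using (⊥-elim)
open import Data.Sum using (_⊎_; inj₁; inj₂; [_,_]′)
open import Data.List.Base using (_∷_; [])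
open import Function using (id)
open import Level using (0ℓ)
open import Relation.Nullary.Decidable using (dec⇒maybe; decidable-stable)
import Data.Nat as ℕ
import Data.Nat.Properties as ℕ
import Data.Nat.DivMod as ℕ
import Data.Nat.Coprimality as Coprime
open import Data.Fin using (Fin; zero; suc; punchIn; punchOut; fromℕ<)
import Data.Fin.Properties as Fin
open import Data.Vec.Functional using (transpose)
import Data.Integer as ℤ
import Data.Integer.Properties as ℤ
open import Data.Rational as ℚ using (ℚ; mkℚ; 0ℚ; 1ℚ)
import Data.Rational.Properties as ℚ
open import Algebra.Properties.Semiring.Sum ℕ.+-*-semiring
  using (sum; sum-syntax; sum-cong-≗; ∑-distrib-+; ∑-comm; sum-remove; *-distribˡ-sum; *-distribʳ-sum)
open import Tactic.RingSolver using (solve-∀; solve)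
open import Tactic.RingSolver.Core.AlmostCommutativeRing using (AlmostCommutativeRing; fromCommutativeRing)
open import Data.Nat.Tactic.RingSolver using () renaming (solve-∀ to ℕ-solve-∀; solve to ℕ-solve)

module _ where
  open import Data.Rational using (_+_; _*_; _-_)
  open import Data.Integer using (+_; -[1+_])

  ℚ-ring : AlmostCommutativeRing 0ℓ 0ℓ
  ℚ-ring = fromCommutativeRing ℚ.+-*-commutativeRing (λ x → dec⇒maybe (0ℚ ℚ.≟ x))

  ι≡mkℚ : ∀ z → ι z ≡ mkℚ z 0 (Coprime.sym (Coprime.1-coprimeTo ℤ.∣ z ∣))
  ι≡mkℚ (+ n) = ℚ.normalize-coprime (Coprime.sym (Coprime.1-coprimeTo n))
  ι≡mkℚ -[1+ n ] = cong ℚ.-_ (ℚ.normalize-coprime (Coprime.sym (Coprime.1-coprimeTo (suc n))))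

  ι-injective : ∀ {a b} → ι a ≡ ι b → a ≡ b
  ι-injective {a} {b} eq = cong ℚ.↥_ (trans (sym (ι≡mkℚ a)) (trans eq (ι≡mkℚ b)))

  ι-* : ∀ a b → ι (a ℤ.* b) ≡ ι a * ι b
  ι-* a b = sym (cong₂ _*_ (ι≡mkℚ a) (ι≡mkℚ b))

  ι-+ : ∀ a b → ι (a ℤ.+ b) ≡ ι a + ι b
  ι-+ a b = sym (trans (cong₂ _+_ (ι≡mkℚ a) (ι≡mkℚ b))
    (cong (ℚ._/ 1) (cong₂ ℤ._+_ (ℤ.*-identityʳ a) (ℤ.*-identityʳ b))))

  ℕ→ℚ-+ : ∀ m n → ℕ→ℚ (m ℕ.+ n) ≡ ℕ→ℚ m + ℕ→ℚ n
  ℕ→ℚ-+ m n = trans (cong ι (ℤ.pos-+ m n)) (ι-+ (+ m) (+ n))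

  ℕ→ℚ-* : ∀ m n → ℕ→ℚ (m ℕ.* n) ≡ ℕ→ℚ m * ℕ→ℚ n
  ℕ→ℚ-* m n = trans (cong ι (ℤ.pos-* m n)) (ι-* (+ m) (+ n))

  ℕ→ℚ-injective : ∀ {m n} → ℕ→ℚ m ≡ ℕ→ℚ n → m ≡ n
  ℕ→ℚ-injective eq = ℤ.+-injective (ι-injective eq)

  ℕ→ℚ-≢0 : ∀ {n} → n ≢ 0 → ℕ→ℚ n ≢ 0ℚ
  ℕ→ℚ-≢0 n≢0 eq = n≢0 (ℕ→ℚ-injective eq)

  floor-ℕ→ℚ : ∀ k → ℕ→ℚ k ⁻ ≡ ℕ→ℚ k
  floor-ℕ→ℚ k = cong ι (integral-floor k)
    where
    integral-floor : ∀ k → ℚ.floor (ℕ→ℚ k) ≡ + k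
    integral-floor k rewrite ι≡mkℚ (+ k) = trans (ℤ.*-identityˡ _) (cong +_ (ℕ.n/1≡n k))

  ceiling-ℕ→ℚ : ∀ k → ℕ→ℚ k ⁺ ≡ ℕ→ℚ k
  ceiling-ℕ→ℚ k = cong ι (integral-ceiling k)
    where
    integral-ceiling : ∀ k → ℚ.ceiling (ℕ→ℚ k) ≡ + k
    integral-ceiling zero = refl
    integral-ceiling (suc k) rewrite ι≡mkℚ (+ suc k) | ℕ.n%1≡0 (suc k) =
      trans (cong ℤ.-_ (ℤ.*-identityˡ _)) (trans (ℤ.neg-involutive _) (cong +_ (ℕ.n/1≡n (suc k))))

  *-inv : ∀ {x} → x ≢ 0ℚ → x * inv x ≡ 1ℚ
  *-inv {mkℚ (+ zero) _ _} x≢0 = ⊥-elim (x≢0 (ℚ.≃⇒≡ (ℚ.*≡* refl)))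
  *-inv {x@(mkℚ ℤ.+[1+ _ ] _ _)} _ = ℚ.*-inverseʳ x
  *-inv {x@(mkℚ -[1+ _ ] _ _)} _ = ℚ.*-inverseʳ x

  ÷-*-cancel : ∀ {x y} → y ≢ 0ℚ → (x ÷ y) * y ≡ x
  ÷-*-cancel {x} {y} y≢0 = begin
    x * inv y * y    ≡⟨ ℚ.*-assoc x (inv y) y ⟩
    x * (inv y * y)  ≡⟨ cong (x *_) (trans (ℚ.*-comm (inv y) y) (*-inv y≢0)) ⟩
    x * 1ℚ           ≡⟨ ℚ.*-identityʳ x ⟩
    x                ∎
    where open ≡-Reasoning

  ÷-unique : ∀ {x y z} → y ≢ 0ℚ → x ≡ z * y → x ÷ y ≡ z
  ÷-unique {y = y} {z} y≢0 refl = begin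
    z * y * inv y    ≡⟨ ℚ.*-assoc z y (inv y) ⟩
    z * (y * inv y)  ≡⟨ cong (z *_) (*-inv y≢0) ⟩
    z * 1ℚ           ≡⟨ ℚ.*-identityʳ z ⟩
    z                ∎
    where open ≡-Reasoning

  ÷-÷-cancel : ∀ {x y z} → y ≢ 0ℚ → z ≢ 0ℚ → (x ÷ (y ÷ z)) * y ≡ x * z
  ÷-÷-cancel {x} {y} {z} y≢0 z≢0 = begin
    x ÷ w * y        ≡⟨ cong (x ÷ w *_) (sym (÷-*-cancel z≢0)) ⟩
    x ÷ w * (w * z)  ≡⟨ sym (ℚ.*-assoc (x ÷ w) w z) ⟩
    x ÷ w * w * z    ≡⟨ cong (_* z) (÷-*-cancel {x} w≢0) ⟩
    x * z            ∎
    where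
    open ≡-Reasoning
    w : ℚ
    w = y ÷ z
    w≢0 : w ≢ 0ℚ
    w≢0 w≡0 = y≢0 (trans (sym (÷-*-cancel z≢0)) (trans (cong (_* z) w≡0) (ℚ.*-zeroˡ z)))

  integral-quotient : ∀ {m n} → n ≢ 0 → IsInteger (ℕ→ℚ m ÷ ℕ→ℚ n)
                    → Σ ℕ λ k → m ≡ k ℕ.* n × ℕ→ℚ m ÷ ℕ→ℚ n ≡ ℕ→ℚ k
  integral-quotient {n = zero} 0≢0 _ = ⊥-elim (0≢0 refl)
  integral-quotient {m} {n@(suc _)} n≢0 (z , m/n≡z) = natural z m≡z*n m/n≡z
    where
    m≡z*n : + m ≡ z ℤ.* + n
    m≡z*n = ι-injective (trans (sym (÷-*-cancel (ℕ→ℚ-≢0 n≢0)))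
                               (trans (cong (_* ℕ→ℚ n) m/n≡z) (sym (ι-* z (+ n)))))
    natural : ∀ z → + m ≡ z ℤ.* + n → ℕ→ℚ m ÷ ℕ→ℚ n ≡ ι z
            → Σ ℕ λ k → m ≡ k ℕ.* n × ℕ→ℚ m ÷ ℕ→ℚ n ≡ ℕ→ℚ k
    natural (+ k) m≡k*n m/n≡k = k , ℤ.+-injective (trans m≡k*n (sym (ℤ.pos-* k n))) , m/n≡k
    natural -[1+ k ] ()

  ℕ→ℚ-cancelʳ : ∀ a b {c} → a ℕ.+ b ≡ c → ℕ→ℚ a ≡ ℕ→ℚ c - ℕ→ℚ b
  ℕ→ℚ-cancelʳ a b refl = sym (trans (cong (_- ℕ→ℚ b) (ℕ→ℚ-+ a b)) (cancel (ℕ→ℚ a) (ℕ→ℚ b)))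
    where cancel : ∀ x y → x + y - y ≡ x
          cancel = solve-∀ ℚ-ring

  *-rescale : ∀ q d x y l → q * d ≡ y * (l - 1ℚ) → q * (x * d) ≡ l * (x * y) - x * y
  *-rescale q d x y l qd≡y[l-1] = begin
    q * (x * d)          ≡⟨ solve (q ∷ d ∷ x ∷ []) ℚ-ring ⟩
    x * (q * d)          ≡⟨ cong (x *_) qd≡y[l-1] ⟩
    x * (y * (l - 1ℚ))   ≡⟨ solve (x ∷ y ∷ l ∷ []) ℚ-ring ⟩
    l * (x * y) - x * y  ∎
    where open ≡-Reasoning

module _ where
  open import Data.Nat using (_+_; _*_; _∸_; ∣_-_∣)

  sumFin≡sum : ∀ {n} (f : Fin n → ℕ) → sumFin f ≡ sum f
  sumFin≡sum {zero} f = refl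
  sumFin≡sum {suc n} f = cong (f zero +_) (sumFin≡sum (λ i → f (suc i)))

  sumFin-cong : ∀ {n} {f g : Fin n → ℕ} → (∀ i → f i ≡ g i) → sumFin f ≡ sumFin g
  sumFin-cong {f = f} {g} f≗g = trans (sumFin≡sum f) (trans (sum-cong-≗ f≗g) (sym (sumFin≡sum g)))

  sumFin²≡∑∑ : ∀ {m n} (f : Fin m → Fin n → ℕ) → sumFin (λ i → sumFin (f i)) ≡ ∑[ i < m ] ∑[ j < n ] f i j
  sumFin²≡∑∑ f = trans (sumFin≡sum λ i → sumFin (f i)) (sum-cong-≗ λ i → sumFin≡sum (f i))

  ∑-const : ∀ n k → ∑[ i < n ] k ≡ n * k
  ∑-const zero k = refl
  ∑-const (suc n) k = cong (k +_) (∑-const n k)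

  ∑∑-const : ∀ m n k → ∑[ i < m ] ∑[ j < n ] k ≡ m * (n * k)
  ∑∑-const m n k = trans (sum-cong-≗ {m} {λ _ → ∑[ j < n ] k} λ _ → ∑-const n k) (∑-const m (n * k))

  ∑≡0⇒≡0 : ∀ {n} (f : Fin n → ℕ) → sum f ≡ 0 → ∀ i → f i ≡ 0
  ∑≡0⇒≡0 f ∑≡0 zero = ℕ.m+n≡0⇒m≡0 (f zero) ∑≡0
  ∑≡0⇒≡0 f ∑≡0 (suc i) = ∑≡0⇒≡0 (λ i → f (suc i)) (ℕ.m+n≡0⇒n≡0 (f zero) ∑≡0) i

  ∑-+-cong : ∀ {n} {f g h l : Fin n → ℕ} → (∀ i → f i + g i ≡ h i + l i)
           → sum f + sum g ≡ sum h + sum l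
  ∑-+-cong {f = f} {g} {h} {l} eq = begin
    sum f + sum g              ≡⟨ ∑-distrib-+ f g ⟨
    ∑[ i < _ ] (f i + g i)     ≡⟨ sum-cong-≗ eq ⟩
    ∑[ i < _ ] (h i + l i)     ≡⟨ ∑-distrib-+ h l ⟩
    sum h + sum l              ∎
    where open ≡-Reasoning

  ∑∑-distrib-+ : ∀ {m n} (f g : Fin m → Fin n → ℕ)
               → ∑[ i < m ] ∑[ j < n ] (f i j + g i j) ≡ ∑[ i < m ] ∑[ j < n ] f i j + ∑[ i < m ] ∑[ j < n ] g i j
  ∑∑-distrib-+ f g =
    trans (sum-cong-≗ λ i → ∑-distrib-+ (f i) (g i)) (∑-distrib-+ (λ i → sum (f i)) (λ i → sum (g i)))

  ∑∑-*ˡ : ∀ {m n} a (f : Fin m → Fin n → ℕ)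
        → ∑[ i < m ] ∑[ j < n ] (a * f i j) ≡ a * ∑[ i < m ] ∑[ j < n ] f i j
  ∑∑-*ˡ a f = sym (trans (*-distribˡ-sum a (λ i → sum (f i))) (sum-cong-≗ λ i → *-distribˡ-sum a (f i)))

  ∑∑-square-+ : ∀ {m n} (f g : Fin m → Fin n → ℕ)
              → ∑[ i < m ] ∑[ j < n ] ((f i j + g i j) * (f i j + g i j))
              ≡ ∑[ i < m ] ∑[ j < n ] (f i j * f i j) + 2 * ∑[ i < m ] ∑[ j < n ] (f i j * g i j)
                + ∑[ i < m ] ∑[ j < n ] (g i j * g i j)
  ∑∑-square-+ {m} {n} f g = begin
    ∑∑ (λ i j → (f i j + g i j) * (f i j + g i j))
      ≡⟨ sum-cong-≗ (λ i → sum-cong-≗ λ j → square (f i j) (g i j)) ⟩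
    ∑∑ (λ i j → f i j * f i j + 2 * (f i j * g i j) + g i j * g i j)
      ≡⟨ ∑∑-distrib-+ (λ i j → f i j * f i j + 2 * (f i j * g i j)) (λ i j → g i j * g i j) ⟩
    ∑∑ (λ i j → f i j * f i j + 2 * (f i j * g i j)) + ∑∑ (λ i j → g i j * g i j)
      ≡⟨ cong (_+ ∑∑ (λ i j → g i j * g i j)) (∑∑-distrib-+ (λ i j → f i j * f i j) (λ i j → 2 * (f i j * g i j))) ⟩
    ∑∑ (λ i j → f i j * f i j) + ∑∑ (λ i j → 2 * (f i j * g i j)) + ∑∑ (λ i j → g i j * g i j)
      ≡⟨ cong (λ x → ∑∑ (λ i j → f i j * f i j) + x + ∑∑ (λ i j → g i j * g i j)) (∑∑-*ˡ 2 (λ i j → f i j * g i j)) ⟩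
    ∑∑ (λ i j → f i j * f i j) + 2 * ∑∑ (λ i j → f i j * g i j) + ∑∑ (λ i j → g i j * g i j)
      ∎
    where
    open ≡-Reasoning
    ∑∑ : (Fin m → Fin n → ℕ) → ℕ
    ∑∑ h = ∑[ i < m ] ∑[ j < n ] h i j
    square : ∀ x y → (x + y) * (x + y) ≡ x * x + 2 * (x * y) + y * y
    square = ℕ-solve-∀

  ∑*∑≡∑∑* : ∀ {m n} (f : Fin m → ℕ) (g : Fin n → ℕ)
          → sum f * sum g ≡ ∑[ i < m ] ∑[ j < n ] (f i * g j)
  ∑*∑≡∑∑* f g = trans (*-distribʳ-sum (sum g) f) (sum-cong-≗ λ i → *-distribˡ-sum (f i) g)

  ∑≢ : ∀ {n} → (Fin n → Fin n → ℕ) → ℕ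
  ∑≢ {zero} f = 0
  ∑≢ {suc n} f = ∑[ i < suc n ] ∑[ j < n ] f i (punchIn i j)

  ∑∑≡∑diagonal+∑≢ : ∀ {n} (f : Fin n → Fin n → ℕ)
                  → ∑[ i < n ] ∑[ j < n ] f i j ≡ ∑[ i < n ] f i i + ∑≢ f
  ∑∑≡∑diagonal+∑≢ {zero} f = refl
  ∑∑≡∑diagonal+∑≢ {suc n} f =
    trans (sum-cong-≗ λ i → sum-remove {i = i} (f i)) (∑-distrib-+ (λ i → f i i) (λ i → ∑[ j < n ] f i (punchIn i j)))

  ∑≢-complement : ∀ {n} (f : Fin n → Fin n → ℕ) {d t}
                → ∑[ i < n ] f i i ≡ d → ∑[ i < n ] ∑[ j < n ] f i j ≡ t → ∑≢ f + d ≡ t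
  ∑≢-complement f {d} diagonal total =
    trans (ℕ.+-comm (∑≢ f) d) (trans (cong (_+ ∑≢ f) (sym diagonal)) (trans (sym (∑∑≡∑diagonal+∑≢ f)) total))

  ∑≢-cong : ∀ {n} {f g : Fin n → Fin n → ℕ} → (∀ i j → f i j ≡ g i j) → ∑≢ f ≡ ∑≢ g
  ∑≢-cong {zero} _ = refl
  ∑≢-cong {suc n} f≗g = sum-cong-≗ λ i → sum-cong-≗ λ j → f≗g i (punchIn i j)

  ∑-off-constant : ∀ {n} (f : Fin n → ℕ) (i : Fin n) {k} → (∀ j → i ≢ j → f j ≡ k)
                 → sum f ≡ f i + (n ∸ 1) * k
  ∑-off-constant {suc n} f i {k} off-i = trans (sum-remove {i = i} f) (cong (f i +_)
    (trans (sum-cong-≗ λ j → off-i (punchIn i j) λ i≡pᵢj → Fin.punchInᵢ≢i i j (sym i≡pᵢj)) (∑-const n k)))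

  ≥2⇒≢0 : ∀ {n} → 2 ℕ.≤ n → n ≢ 0
  ≥2⇒≢0 (ℕ.s≤s _) ()

  ≥2⇒pred≢0 : ∀ {n} → 2 ℕ.≤ n → n ∸ 1 ≢ 0
  ≥2⇒pred≢0 (ℕ.s≤s (ℕ.s≤s _)) ()

  *-pred+self : ∀ n → n * (n ∸ 1) + n ≡ n * n
  *-pred+self zero = refl
  *-pred+self (suc m) = identity m
    where identity : ∀ m → suc m * m + suc m ≡ suc m * suc m
          identity = ℕ-solve-∀

  equal-row-sums⇒equal : ∀ {x y d} p → p ≢ 0 → x * (p + 2) ≡ x + x + d → y * (p + 2) ≡ y + y + d → x ≡ y
  equal-row-sums⇒equal {x} {y} {d} p p≢0 x-row y-row =
    ℕ.*-cancelʳ-≡ x y p {{ℕ.≢-nonZero p≢0}} (trans (solve-for x x-row) (sym (solve-for y y-row)))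
    where
    solve-for : ∀ z → z * (p + 2) ≡ z + z + d → z * p ≡ d
    solve-for z z-row = ℕ.+-cancelˡ-≡ (z + z) (z * p) d (trans (identity z p) z-row)
      where identity : ∀ z p → z + z + z * p ≡ z * (p + 2)
            identity = ℕ-solve-∀

  ∣m-n∣²+2mn : ∀ m n → ∣ m - n ∣ * ∣ m - n ∣ + 2 * (m * n) ≡ m * m + n * n
  ∣m-n∣²+2mn m n with ℕ.≤-total m n
  ... | inj₁ m≤n with ℕ.m≤n⇒∃[o]m+o≡n m≤n
  ...   | d , refl rewrite ℕ.∣m-m+n∣≡n m d = ℕ-solve (m ∷ d ∷ [])
  ∣m-n∣²+2mn m n | inj₂ n≤m with ℕ.m≤n⇒∃[o]m+o≡n n≤m
  ...   | d , refl rewrite ℕ.∣-∣-comm (n + d) n | ℕ.∣m-m+n∣≡n n d = ℕ-solve (n ∷ d ∷ [])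

  constant-of-zero-variance : ∀ {m n} (x : Fin m → Fin n → ℕ) k
    → ∑[ i < m ] ∑[ j < n ] x i j ≡ (m * n) * k
    → ∑[ i < m ] ∑[ j < n ] (x i j * x i j) ≡ (m * n) * (k * k)
    → ∀ i j → x i j ≡ k
  constant-of-zero-variance {m} {n} x k ∑x ∑x² i j =
    ℕ.∣m-n∣≡0⇒m≡n (square≡0 (∑≡0⇒≡0 (dev i) (∑≡0⇒≡0 (λ i → sum (dev i)) ∑dev≡0 i) j))
    where
    dev : Fin m → Fin n → ℕ
    dev i j = ∣ x i j - k ∣ * ∣ x i j - k ∣
    square≡0 : ∀ {a} → a * a ≡ 0 → a ≡ 0
    square≡0 {a} eq = [ id , id ]′ (ℕ.m*n≡0⇒m≡0∨n≡0 a eq)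
    ∑∑ : (Fin m → Fin n → ℕ) → ℕ
    ∑∑ f = ∑[ i < m ] ∑[ j < n ] f i j
    ∑dev≡0 : ∑∑ dev ≡ 0
    ∑dev≡0 = ℕ.+-cancelʳ-≡ (2 * k * ((m * n) * k)) (∑∑ dev) 0 (begin
      ∑∑ dev + 2 * k * ((m * n) * k)              ≡⟨ cong (∑∑ dev +_) (cong (2 * k *_) ∑x) ⟨
      ∑∑ dev + 2 * k * ∑∑ x                        ≡⟨ cong (∑∑ dev +_) (∑∑-*ˡ (2 * k) x) ⟨
      ∑∑ dev + ∑∑ (λ i j → 2 * k * x i j)          ≡⟨ ∑-+-cong (λ i → ∑-+-cong (λ j → pointwise (x i j))) ⟩
      ∑∑ (λ i j → x i j * x i j) + ∑∑ (λ _ _ → k * k)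
                                                   ≡⟨ cong₂ _+_ ∑x² (∑∑-const m n (k * k)) ⟩
      (m * n) * (k * k) + m * (n * (k * k))        ≡⟨ rearrange m n k ⟩
      0 + 2 * k * ((m * n) * k)                    ∎)
      where
      open ≡-Reasoning
      pointwise : ∀ y → ∣ y - k ∣ * ∣ y - k ∣ + 2 * k * y ≡ y * y + k * k
      pointwise y = trans (cong (∣ y - k ∣ * ∣ y - k ∣ +_) (swap y k)) (∣m-n∣²+2mn y k)
        where swap : ∀ y k → 2 * k * y ≡ 2 * (y * k)
              swap = ℕ-solve-∀
      rearrange : ∀ m n k → (m * n) * (k * k) + m * (n * (k * k)) ≡ 0 + 2 * k * ((m * n) * k)
      rearrange = ℕ-solve-∀

  constant-of-zero-variance≢ : ∀ {n} (x : Fin n → Fin n → ℕ) k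
    → ∑≢ x ≡ (n * (n ∸ 1)) * k
    → ∑≢ (λ i j → x i j * x i j) ≡ (n * (n ∸ 1)) * (k * k)
    → ∀ i j → i ≢ j → x i j ≡ k
  constant-of-zero-variance≢ {suc n} x k ∑x ∑x² i j i≢j =
    subst (λ j → x i j ≡ k) (Fin.punchIn-punchOut i≢j)
      (constant-of-zero-variance (λ i j → x i (punchIn i j)) k ∑x ∑x² i (punchOut i≢j))

-- Families of naturals taking two values

module _ where
  open import Data.Rational using (_+_; _*_; _-_)

  -- chord m is the value at m of the chord of x ↦ x(x−1) between ⌊m⌋ and ⌈m⌉,
  -- so that S n m = n · chord m / 2.
  chord : ℚ → ℚ
  chord m = (m ⁻ + m ⁺) * m - m ⁻ * m ⁺ - m

  S*2≡n*chord : ∀ n m → S n m * ℕ→ℚ 2 ≡ ℕ→ℚ n * chord m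
  S*2≡n*chord n m = begin
    S n m * ℕ→ℚ 2                           ≡⟨ expand (ℕ→ℚ n) m (m ⁻) (m ⁺) (inv (ℕ→ℚ 2)) ⟩
    ℕ→ℚ n * chord m * (inv (ℕ→ℚ 2) * ℕ→ℚ 2)  ≡⟨ cong (ℕ→ℚ n * chord m *_) ½*2≡1 ⟩
    ℕ→ℚ n * chord m * 1ℚ                    ≡⟨ ℚ.*-identityʳ _ ⟩
    ℕ→ℚ n * chord m                         ∎
    where
    open ≡-Reasoning
    ½*2≡1 : inv (ℕ→ℚ 2) * ℕ→ℚ 2 ≡ 1ℚ
    ½*2≡1 = trans (ℚ.*-comm (inv (ℕ→ℚ 2)) (ℕ→ℚ 2)) (*-inv {ℕ→ℚ 2} λ ())
    expand : ∀ N x a b h → (N * (x * (x - 1ℚ) * h) + N * (x - a) * (b - x) * h) * ℕ→ℚ 2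
                         ≡ N * ((a + b) * x - a * b - x) * (h * ℕ→ℚ 2)
    expand = solve-∀ ℚ-ring

  chord-ℕ→ℚ : ∀ k → chord (ℕ→ℚ k) ≡ ℕ→ℚ k * ℕ→ℚ k - ℕ→ℚ k
  chord-ℕ→ℚ k rewrite floor-ℕ→ℚ k | ceiling-ℕ→ℚ k = identity (ℕ→ℚ k)
    where
    identity : ∀ x → (x + x) * x - x * x - x ≡ x * x - x
    identity = solve-∀ ℚ-ring

  ∑-linear : ∀ {n} (f g h : Fin n → ℕ) (α β : ℚ)
           → (∀ i → ℕ→ℚ (f i) + β * ℕ→ℚ (g i) ≡ α * ℕ→ℚ (h i))
           → ℕ→ℚ (sum f) + β * ℕ→ℚ (sum g) ≡ α * ℕ→ℚ (sum h)
  ∑-linear {zero} f g h α β _ = empty α β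
    where empty : ∀ α β → 0ℚ + β * 0ℚ ≡ α * 0ℚ
          empty = solve-∀ ℚ-ring
  ∑-linear {suc n} f g h α β eq = begin
    ℕ→ℚ (f zero ℕ.+ sum f′) + β * ℕ→ℚ (g zero ℕ.+ sum g′)
      ≡⟨ cong₂ (λ x y → x + β * y) (ℕ→ℚ-+ (f zero) (sum f′)) (ℕ→ℚ-+ (g zero) (sum g′)) ⟩
    (ℕ→ℚ (f zero) + ℕ→ℚ (sum f′)) + β * (ℕ→ℚ (g zero) + ℕ→ℚ (sum g′))
      ≡⟨ regroup (ℕ→ℚ (f zero)) (ℕ→ℚ (sum f′)) (ℕ→ℚ (g zero)) (ℕ→ℚ (sum g′)) β ⟩
    (ℕ→ℚ (f zero) + β * ℕ→ℚ (g zero)) + (ℕ→ℚ (sum f′) + β * ℕ→ℚ (sum g′))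
      ≡⟨ cong₂ _+_ (eq zero) (∑-linear f′ g′ h′ α β (λ i → eq (suc i))) ⟩
    α * ℕ→ℚ (h zero) + α * ℕ→ℚ (sum h′)
      ≡⟨ ℚ.*-distribˡ-+ α (ℕ→ℚ (h zero)) (ℕ→ℚ (sum h′)) ⟨
    α * (ℕ→ℚ (h zero) + ℕ→ℚ (sum h′))
      ≡⟨ cong (α *_) (ℕ→ℚ-+ (h zero) (sum h′)) ⟨
    α * ℕ→ℚ (h zero ℕ.+ sum h′)
      ∎
    where
    open ≡-Reasoning
    f′ g′ h′ : Fin n → ℕ
    f′ i = f (suc i)
    g′ i = g (suc i)
    h′ i = h (suc i)
    regroup : ∀ x x′ y y′ β → (x + x′) + β * (y + y′) ≡ (x + β * y) + (x′ + β * y′)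
    regroup = solve-∀ ℚ-ring

  square-of-root : ∀ {a b : ℚ} y → ℕ→ℚ y ≡ a ⊎ ℕ→ℚ y ≡ b
                 → ℕ→ℚ (y ℕ.* y) + a * b * ℕ→ℚ 1 ≡ (a + b) * ℕ→ℚ y
  square-of-root {a} {b} y y∈ab rewrite ℕ→ℚ-* y y with y∈ab
  ... | inj₁ refl = identity (ℕ→ℚ y) b
    where identity : ∀ a b → a * a + a * b * 1ℚ ≡ (a + b) * a
          identity = solve-∀ ℚ-ring
  ... | inj₂ refl = identity a (ℕ→ℚ y)
    where identity : ∀ a b → b * b + a * b * 1ℚ ≡ (a + b) * b
          identity = solve-∀ ℚ-ring

  floorCeil-moment : ∀ {n} (x : Fin n → ℕ) {a b : ℚ}
    → (∀ i → ℕ→ℚ (x i) ≡ a ⊎ ℕ→ℚ (x i) ≡ b)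
    → ℕ→ℚ (∑[ i < n ] (x i ℕ.* x i)) + a * b * ℕ→ℚ n ≡ (a + b) * ℕ→ℚ (sum x)
  floorCeil-moment {n} x {a} {b} x∈ab =
    subst (λ k → ℕ→ℚ (∑[ i < n ] (x i ℕ.* x i)) + a * b * ℕ→ℚ k ≡ (a + b) * ℕ→ℚ (sum x))
      (trans (∑-const n 1) (ℕ.*-identityʳ n))
      (∑-linear (λ i → x i ℕ.* x i) (λ _ → 1) x (a + b) (a * b) λ i → square-of-root (x i) (x∈ab i))

  floorCeil-moment₂ : ∀ {m n} (x : Fin m → Fin n → ℕ) {a b : ℚ}
    → (∀ i j → ℕ→ℚ (x i j) ≡ a ⊎ ℕ→ℚ (x i j) ≡ b)
    → ℕ→ℚ (∑[ i < m ] ∑[ j < n ] (x i j ℕ.* x i j)) + a * b * ℕ→ℚ (m ℕ.* n)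
      ≡ (a + b) * ℕ→ℚ (∑[ i < m ] ∑[ j < n ] x i j)
  floorCeil-moment₂ {m} {n} x {a} {b} x∈ab =
    subst (λ k → ℕ→ℚ (∑[ i < m ] ∑[ j < n ] (x i j ℕ.* x i j)) + a * b * ℕ→ℚ k
                 ≡ (a + b) * ℕ→ℚ (∑[ i < m ] ∑[ j < n ] x i j))
      (∑-const m n)
      (∑-linear (λ i → ∑[ j < n ] (x i j ℕ.* x i j)) (λ _ → n) (λ i → sum (x i)) (a + b) (a * b)
        λ i → floorCeil-moment (x i) (x∈ab i))

  floorCeil-moment≢ : ∀ {n} (x : Fin n → Fin n → ℕ) {a b : ℚ}
    → (∀ i j → i ≢ j → ℕ→ℚ (x i j) ≡ a ⊎ ℕ→ℚ (x i j) ≡ b)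
    → ℕ→ℚ (∑≢ (λ i j → x i j ℕ.* x i j)) + a * b * ℕ→ℚ (n ℕ.* (n ℕ.∸ 1))
      ≡ (a + b) * ℕ→ℚ (∑≢ x)
  floorCeil-moment≢ {zero} x {a} {b} _ = empty a b
    where empty : ∀ a b → 0ℚ + a * b * 0ℚ ≡ (a + b) * 0ℚ
          empty = solve-∀ ℚ-ring
  floorCeil-moment≢ {suc n} x x∈ab =
    floorCeil-moment₂ (λ i j → x i (punchIn i j)) λ i j → x∈ab i (punchIn i j) (λ i≡ → Fin.punchInᵢ≢i i j (sym i≡))

  moment⇒chord : ∀ Q X N m → Q + m ⁻ * m ⁺ * N ≡ (m ⁻ + m ⁺) * X → X ≡ N * m
               → Q - X ≡ N * chord m
  moment⇒chord Q _ N m moment refl = generic Q N m (m ⁻) (m ⁺) moment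
    where
    generic : ∀ Q N m a b → Q + a * b * N ≡ (a + b) * (N * m)
            → Q - N * m ≡ N * ((a + b) * m - a * b - m)
    generic Q N m a b moment = begin
      Q - N * m                                ≡⟨ solve (Q ∷ N ∷ m ∷ a ∷ b ∷ []) ℚ-ring ⟩
      (Q + a * b * N) - a * b * N - N * m      ≡⟨ cong (λ t → t - a * b * N - N * m) moment ⟩
      (a + b) * (N * m) - a * b * N - N * m    ≡⟨ solve (N ∷ m ∷ a ∷ b ∷ []) ℚ-ring ⟩
      N * ((a + b) * m - a * b - m)            ∎
      where open ≡-Reasoning

module _ where
  open import Data.Nat using (_+_; _*_; _∸_; _≤_)
  open import Data.Nat.Divisibility using (_∣_)
  open import Data.Nat.Combinatorics.Specification using (k!∣nP′k)

  ch2*2 : ∀ {n} → 2 ≤ n → ch2 n * 2 ≡ n * (n ∸ 1)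
  ch2*2 {n} 2≤n = ℕ.m/n*n≡m (subst (2 ∣_) (trans (cong ((n ∸ 1) *_) (ℕ.*-identityʳ n)) (ℕ.*-comm (n ∸ 1) n))
                                           (k!∣nP′k 2≤n))

  pairs-identity : ∀ {r c} → 2 ≤ r → 2 ≤ c
                 → r * (c * c) + c * (r * r) ≡ (ch2 c * r + ch2 r * c) * 2 + 2 * (r * c)
  pairs-identity {r} {c} 2≤r 2≤c = begin
    r * (c * c) + c * (r * r)
      ≡⟨ cong₂ (λ x y → r * x + c * y) (*-pred+self c) (*-pred+self r) ⟨
    r * (c * (c ∸ 1) + c) + c * (r * (r ∸ 1) + r)
      ≡⟨ expand r c (c * (c ∸ 1)) (r * (r ∸ 1)) ⟩
    c * (c ∸ 1) * r + r * (r ∸ 1) * c + 2 * (r * c)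
      ≡⟨ cong₂ (λ x y → x * r + y * c + 2 * (r * c)) (ch2*2 2≤c) (ch2*2 2≤r) ⟨
    ch2 c * 2 * r + ch2 r * 2 * c + 2 * (r * c)
      ≡⟨ factor (ch2 c) (ch2 r) r c ⟩
    (ch2 c * r + ch2 r * c) * 2 + 2 * (r * c)
      ∎
    where
    open ≡-Reasoning
    expand : ∀ r c x y → r * (x + c) + c * (y + r) ≡ x * r + y * c + 2 * (r * c)
    expand = ℕ-solve-∀
    factor : ∀ a b r c → a * 2 * r + b * 2 * c + 2 * (r * c) ≡ (a * r + b * c) * 2 + 2 * (r * c)
    factor = ℕ-solve-∀

  S*4 : ∀ n m → S n m ℚ.* ℕ→ℚ 4 ≡ ℕ→ℚ 2 ℚ.* (ℕ→ℚ n ℚ.* chord m)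
  S*4 n m = begin
    S n m ℚ.* ℕ→ℚ 4                    ≡⟨ ℚ.*-assoc (S n m) (ℕ→ℚ 2) (ℕ→ℚ 2) ⟨
    S n m ℚ.* ℕ→ℚ 2 ℚ.* ℕ→ℚ 2          ≡⟨ cong (ℚ._* ℕ→ℚ 2) (S*2≡n*chord n m) ⟩
    ℕ→ℚ n ℚ.* chord m ℚ.* ℕ→ℚ 2        ≡⟨ ℚ.*-comm (ℕ→ℚ n ℚ.* chord m) (ℕ→ℚ 2) ⟩
    ℕ→ℚ 2 ℚ.* (ℕ→ℚ n ℚ.* chord m)      ∎
    where open ≡-Reasoning

  S-ch2*4 : ∀ {n} → 2 ≤ n → ∀ m → S (ch2 n) m ℚ.* ℕ→ℚ 4 ≡ ℕ→ℚ (n * (n ∸ 1)) ℚ.* chord m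
  S-ch2*4 {n} 2≤n m = begin
    S (ch2 n) m ℚ.* ℕ→ℚ 4                   ≡⟨ S*4 (ch2 n) m ⟩
    ℕ→ℚ 2 ℚ.* (ℕ→ℚ (ch2 n) ℚ.* chord m)     ≡⟨ swap (ℕ→ℚ (ch2 n)) (chord m) ⟩
    ℕ→ℚ (ch2 n) ℚ.* ℕ→ℚ 2 ℚ.* chord m       ≡⟨ cong (ℚ._* chord m) (ℕ→ℚ-* (ch2 n) 2) ⟨
    ℕ→ℚ (ch2 n * 2) ℚ.* chord m             ≡⟨ cong (λ x → ℕ→ℚ x ℚ.* chord m) (ch2*2 2≤n) ⟩
    ℕ→ℚ (n * (n ∸ 1)) ℚ.* chord m           ∎
    where
    open ≡-Reasoning
    swap : ∀ x y → ℕ→ℚ 2 ℚ.* (x ℚ.* y) ≡ x ℚ.* ℕ→ℚ 2 ℚ.* y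
    swap = solve-∀ ℚ-ring

module _ where
  open import Data.Nat using (_+_; _*_)
  open ≡-Reasoning

  meet : ∀ {a b v} → (Fin a → Fin v → ℕ) → (Fin b → Fin v → ℕ) → Fin a → Fin b → ℕ
  meet {v = v} M N i j = ∑[ s < v ] (M i s * N j s)

  ∑∑-meet : ∀ {a b v} (M : Fin a → Fin v → ℕ) (N : Fin b → Fin v → ℕ)
          → ∑[ i < a ] ∑[ j < b ] meet M N i j ≡ ∑[ s < v ] (∑[ i < a ] M i s * ∑[ j < b ] N j s)
  ∑∑-meet {a} {b} {v} M N = begin
    ∑[ i < a ] ∑[ j < b ] ∑[ s < v ] (M i s * N j s)   ≡⟨ sum-cong-≗ (λ i → ∑-comm (λ j s → M i s * N j s)) ⟩
    ∑[ i < a ] ∑[ s < v ] ∑[ j < b ] (M i s * N j s)   ≡⟨ ∑-comm (λ i s → ∑[ j < b ] (M i s * N j s)) ⟩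
    ∑[ s < v ] ∑[ i < a ] ∑[ j < b ] (M i s * N j s)   ≡⟨ sum-cong-≗ (λ s → ∑*∑≡∑∑* (λ i → M i s) (λ j → N j s)) ⟨
    ∑[ s < v ] (∑[ i < a ] M i s * ∑[ j < b ] N j s)   ∎

  ∑∑∑∑-comm : ∀ {a b v w} (F : Fin v → Fin w → Fin a → Fin b → ℕ)
            → ∑[ s < v ] ∑[ t < w ] ∑[ i < a ] ∑[ j < b ] F s t i j
            ≡ ∑[ i < a ] ∑[ j < b ] ∑[ s < v ] ∑[ t < w ] F s t i j
  ∑∑∑∑-comm {a} {b} {v} {w} F = begin
    ∑[ s < v ] ∑[ t < w ] ∑[ i < a ] ∑[ j < b ] F s t i j
      ≡⟨ sum-cong-≗ (λ s → ∑-comm (λ t i → ∑[ j < b ] F s t i j)) ⟩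
    ∑[ s < v ] ∑[ i < a ] ∑[ t < w ] ∑[ j < b ] F s t i j
      ≡⟨ ∑-comm (λ s i → ∑[ t < w ] ∑[ j < b ] F s t i j) ⟩
    ∑[ i < a ] ∑[ s < v ] ∑[ t < w ] ∑[ j < b ] F s t i j
      ≡⟨ sum-cong-≗ (λ i → sum-cong-≗ (λ s → ∑-comm (λ t j → F s t i j))) ⟩
    ∑[ i < a ] ∑[ s < v ] ∑[ j < b ] ∑[ t < w ] F s t i j
      ≡⟨ sum-cong-≗ (λ i → ∑-comm (λ s j → ∑[ t < w ] F s t i j)) ⟩
    ∑[ i < a ] ∑[ j < b ] ∑[ s < v ] ∑[ t < w ] F s t i j
      ∎

  ∑∑-meet² : ∀ {a b v} (M : Fin a → Fin v → ℕ) (N : Fin b → Fin v → ℕ)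
           → ∑[ s < v ] ∑[ t < v ] (meet (transpose M) (transpose M) s t * meet (transpose N) (transpose N) s t)
           ≡ ∑[ i < a ] ∑[ j < b ] (meet M N i j * meet M N i j)
  ∑∑-meet² {a} {b} {v} M N = begin
    ∑[ s < v ] ∑[ t < v ] (∑[ i < a ] (M i s * M i t) * ∑[ j < b ] (N j s * N j t))
      ≡⟨ sum-cong-≗ (λ s → sum-cong-≗ λ t → ∑*∑≡∑∑* (λ i → M i s * M i t) (λ j → N j s * N j t)) ⟩
    ∑[ s < v ] ∑[ t < v ] ∑[ i < a ] ∑[ j < b ] ((M i s * M i t) * (N j s * N j t))
      ≡⟨ ∑∑∑∑-comm (λ s t i j → (M i s * M i t) * (N j s * N j t)) ⟩
    ∑[ i < a ] ∑[ j < b ] ∑[ s < v ] ∑[ t < v ] ((M i s * M i t) * (N j s * N j t))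
      ≡⟨ sum-cong-≗ (λ i → sum-cong-≗ λ j → sum-cong-≗ λ s → sum-cong-≗ λ t →
           interchange (M i s) (M i t) (N j s) (N j t)) ⟩
    ∑[ i < a ] ∑[ j < b ] ∑[ s < v ] ∑[ t < v ] ((M i s * N j s) * (M i t * N j t))
      ≡⟨ sum-cong-≗ (λ i → sum-cong-≗ λ j → ∑*∑≡∑∑* (λ s → M i s * N j s) (λ t → M i t * N j t)) ⟨
    ∑[ i < a ] ∑[ j < b ] (meet M N i j * meet M N i j)
      ∎
    where
    interchange : ∀ w x y z → (w * x) * (y * z) ≡ (w * y) * (x * z)
    interchange = ℕ-solve-∀

𝟙 : ∀ {P : Set} → Dec P → ℕ
𝟙 (yes _) = 1
𝟙 (no _) = 0

module _ where
  open import Data.Nat using (_+_; _*_)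

  𝟙-true : ∀ {P : Set} (d : Dec P) → P → 𝟙 d ≡ 1
  𝟙-true (yes _) _ = refl
  𝟙-true (no ¬p) p = ⊥-elim (¬p p)

  𝟙-false : ∀ {P : Set} (d : Dec P) → ¬ P → 𝟙 d ≡ 0
  𝟙-false (yes p) ¬p = ⊥-elim (¬p p)
  𝟙-false (no _) _ = refl

  𝟙-idem : ∀ {P : Set} (d : Dec P) → 𝟙 d * 𝟙 d ≡ 𝟙 d
  𝟙-idem (yes _) = refl
  𝟙-idem (no _) = refl

  count≡∑𝟙 : ∀ {n} {P : Fin n → Set} (P? : ∀ i → Dec (P i)) → count P? ≡ ∑[ i < n ] 𝟙 (P? i)
  count≡∑𝟙 {zero} P? = refl
  count≡∑𝟙 {suc n} P? with P? zero
  ... | yes _ = cong suc (count≡∑𝟙 (λ i → P? (suc i)))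
  ... | no _ = count≡∑𝟙 (λ i → P? (suc i))

  ∑𝟙-none : ∀ {n} {P : Fin n → Set} (P? : ∀ i → Dec (P i)) → (∀ i → ¬ P i) → ∑[ i < n ] 𝟙 (P? i) ≡ 0
  ∑𝟙-none {n} P? none = trans (sum-cong-≗ λ i → 𝟙-false (P? i) (none i)) (trans (∑-const n 0) (ℕ.*-zeroʳ n))

  ∑𝟙-unique : ∀ {n} {P : Fin n → Set} (P? : ∀ i → Dec (P i)) (i : Fin n)
            → P i → (∀ {j} → P j → i ≡ j) → ∑[ j < n ] 𝟙 (P? j) ≡ 1
  ∑𝟙-unique {suc n} {P} P? i p only-i = begin
    sum (λ j → 𝟙 (P? j))                          ≡⟨ sum-remove {i = i} (λ j → 𝟙 (P? j)) ⟩
    𝟙 (P? i) + ∑[ j < n ] 𝟙 (P? (punchIn i j))    ≡⟨ cong₂ _+_ (𝟙-true (P? i) p) (∑𝟙-none _ elsewhere) ⟩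
    1                                             ∎
    where
    open ≡-Reasoning
    elsewhere : ∀ j → ¬ P (punchIn i j)
    elsewhere j q = Fin.punchInᵢ≢i i j (sym (only-i q))

  ∑𝟙-atMostOne : ∀ {n} {P : Fin n → Set} (P? : ∀ i → Dec (P i))
               → (∀ {i j} → P i → P j → i ≡ j) → ∑[ i < n ] 𝟙 (P? i) ≡ 𝟙 (Fin.any? P?)
  ∑𝟙-atMostOne P? atMostOne with Fin.any? P?
  ... | yes (i , p) = ∑𝟙-unique P? i p (atMostOne p)
  ... | no ¬∃ = ∑𝟙-none P? λ i p → ¬∃ (i , p)

unless : ∀ {P : Set} → Dec P → ℕ → ℕ
unless (yes _) _ = 0
unless (no _) x = x

unless-true : ∀ {P : Set} (d : Dec P) x → P → unless d x ≡ 0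
unless-true (yes _) _ _ = refl
unless-true (no ¬p) _ p = ⊥-elim (¬p p)

unless-false : ∀ {P : Set} (d : Dec P) x → ¬ P → unless d x ≡ x
unless-false (yes p) _ ¬p = ⊥-elim (¬p p)
unless-false (no _) _ _ = refl

∑∑-unless≡∑≢ : ∀ {n} (f : Fin n → Fin n → ℕ) → ∑[ i < n ] ∑[ j < n ] unless (i Fin.≟ j) (f i j) ≡ ∑≢ f
∑∑-unless≡∑≢ {zero} f = refl
∑∑-unless≡∑≢ {suc n} f = sum-cong-≗ λ i →
  trans (sum-remove {i = i} (λ j → unless (i Fin.≟ j) (f i j)))
        (cong₂ ℕ._+_ (unless-true (i Fin.≟ i) (f i i) refl)
                     (sum-cong-≗ λ j → unless-false (i Fin.≟ punchIn i j) _ λ i≡pᵢj → Fin.punchInᵢ≢i i j (sym i≡pᵢj)))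

mutual
  sumDistinct≡∑∑-unless : ∀ {r c v} (A : Design r c v) {n} (f : Fin n → Fin n → ℕ)
                        → sumDistinct A f ≡ ∑[ i < n ] ∑[ j < n ] unless (i Fin.≟ j) (f i j)
  sumDistinct≡∑∑-unless A f =
    trans (sumFin-cong λ i → sumFin-cong λ j → sumDistinct-summand A f i j)
          (trans (sumFin≡sum λ i → sumFin λ j → unless (i Fin.≟ j) (f i j))
                 (sum-cong-≗ λ i → sumFin≡sum λ j → unless (i Fin.≟ j) (f i j)))

  -- The summand of sumDistinct is a where-bound function of Defs that cannot be named, so the
  -- type below is left to unification with the use above.
  sumDistinct-summand : ∀ {r c v} (A : Design r c v) {n} (f : Fin n → Fin n → ℕ) (i j : Fin n)
                      → _ ≡ unless (i Fin.≟ j) (f i j)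
  sumDistinct-summand A f i j with i Fin.≟ j
  ... | yes _ = refl
  ... | no _ = refl

sumDistinct≡∑≢ : ∀ {r c v} (A : Design r c v) {n} (f : Fin n → Fin n → ℕ) → sumDistinct A f ≡ ∑≢ f
sumDistinct≡∑≢ A f = trans (sumDistinct≡∑∑-unless A f) (∑∑-unless≡∑≢ f)

-- Binary row–column designs

module Incidence {r c v} (A : Design r c v) where
  open import Data.Nat using (_+_; _*_; _∸_)
  open ≡-Reasoning

  row : Fin r → Fin v → ℕ
  row i s = 𝟙 (inRow? A i s)

  col : Fin c → Fin v → ℕ
  col j s = 𝟙 (inCol? A j s)

  T : ℕ
  T = ∑[ s < v ] (replication A s * replication A s)

  concurrence : Fin v → Fin v → ℕ
  concurrence s t = meet (transpose row) (transpose row) s t + meet (transpose col) (transpose col) s t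

  Σrc Σrc² Σrr Σrr² Σcc Σcc² Σconc Σconc² : ℕ
  Σrc = ∑[ i < r ] ∑[ j < c ] meet row col i j
  Σrc² = ∑[ i < r ] ∑[ j < c ] (meet row col i j * meet row col i j)
  Σrr = ∑≢ (meet row row)
  Σrr² = ∑≢ (λ i i′ → meet row row i i′ * meet row row i i′)
  Σcc = ∑≢ (meet col col)
  Σcc² = ∑≢ (λ j j′ → meet col col j j′ * meet col col j j′)
  Σconc = ∑≢ concurrence
  Σconc² = ∑≢ (λ s t → concurrence s t * concurrence s t)

  𝟙-both : ∀ {P Q : Set} (d : Dec P) (e : Dec Q) → 𝟙 (both? A d e) ≡ 𝟙 d * 𝟙 e
  𝟙-both (yes _) (yes _) = refl
  𝟙-both (yes _) (no _) = refl
  𝟙-both (no _) _ = refl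

  rc∩≡meet : ∀ i j → rc∩ A i j ≡ meet row col i j
  rc∩≡meet i j = trans (count≡∑𝟙 λ s → both? A (inRow? A i s) (inCol? A j s))
                       (sum-cong-≗ λ s → 𝟙-both (inRow? A i s) (inCol? A j s))

  rr∩≡meet : ∀ i i′ → rr∩ A i i′ ≡ meet row row i i′
  rr∩≡meet i i′ = trans (count≡∑𝟙 λ s → both? A (inRow? A i s) (inRow? A i′ s))
                        (sum-cong-≗ λ s → 𝟙-both (inRow? A i s) (inRow? A i′ s))

  cc∩≡meet : ∀ j j′ → cc∩ A j j′ ≡ meet col col j j′
  cc∩≡meet j j′ = trans (count≡∑𝟙 λ s → both? A (inCol? A j s) (inCol? A j′ s))
                        (sum-cong-≗ λ s → 𝟙-both (inCol? A j s) (inCol? A j′ s))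

  each-cell-one-symbol : ∀ i j → ∑[ s < v ] 𝟙 (A i j Fin.≟ s) ≡ 1
  each-cell-one-symbol i j = ∑𝟙-unique (A i j Fin.≟_) (A i j) refl id

  module Counting (binary : Binary A) where

    occurrences-in-row : ∀ i s → count (λ j → A i j Fin.≟ s) ≡ row i s
    occurrences-in-row i s = trans (count≡∑𝟙 P?) (∑𝟙-atMostOne P? λ {j} {j′} Aij≡s Aij′≡s →
      decidable-stable (j Fin.≟ j′) λ j≢j′ → proj₁ binary i j j′ j≢j′ (trans Aij≡s (sym Aij′≡s)))
      where
      P? : ∀ j → Dec (A i j ≡ s)
      P? j = A i j Fin.≟ s

    occurrences-in-col : ∀ j s → count (λ i → A i j Fin.≟ s) ≡ col j s
    occurrences-in-col j s = trans (count≡∑𝟙 P?) (∑𝟙-atMostOne P? λ {i} {i′} Aij≡s Ai′j≡s →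
      decidable-stable (i Fin.≟ i′) λ i≢i′ → proj₂ binary j i i′ i≢i′ (trans Aij≡s (sym Ai′j≡s)))
      where
      P? : ∀ i → Dec (A i j ≡ s)
      P? i = A i j Fin.≟ s

    replication≡∑row : ∀ s → replication A s ≡ ∑[ i < r ] row i s
    replication≡∑row s =
      trans (sumFin≡sum λ i → count (λ j → A i j Fin.≟ s)) (sum-cong-≗ λ i → occurrences-in-row i s)

    replication≡∑col : ∀ s → replication A s ≡ ∑[ j < c ] col j s
    replication≡∑col s = begin
      replication A s                                  ≡⟨ sumFin≡sum (λ i → count (λ j → A i j Fin.≟ s)) ⟩
      ∑[ i < r ] count (λ j → A i j Fin.≟ s)           ≡⟨ sum-cong-≗ (λ i → count≡∑𝟙 (λ j → A i j Fin.≟ s)) ⟩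
      ∑[ i < r ] ∑[ j < c ] 𝟙 (A i j Fin.≟ s)          ≡⟨ ∑-comm (λ i j → 𝟙 (A i j Fin.≟ s)) ⟩
      ∑[ j < c ] ∑[ i < r ] 𝟙 (A i j Fin.≟ s)          ≡⟨ sum-cong-≗ (λ j → count≡∑𝟙 (λ i → A i j Fin.≟ s)) ⟨
      ∑[ j < c ] count (λ i → A i j Fin.≟ s)           ≡⟨ sum-cong-≗ (λ j → occurrences-in-col j s) ⟩
      ∑[ j < c ] col j s                               ∎

    ∑row≡c : ∀ i → ∑[ s < v ] row i s ≡ c
    ∑row≡c i = begin
      ∑[ s < v ] row i s                               ≡⟨ sum-cong-≗ (λ s → occurrences-in-row i s) ⟨
      ∑[ s < v ] count (λ j → A i j Fin.≟ s)           ≡⟨ sum-cong-≗ (λ s → count≡∑𝟙 (λ j → A i j Fin.≟ s)) ⟩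
      ∑[ s < v ] ∑[ j < c ] 𝟙 (A i j Fin.≟ s)          ≡⟨ ∑-comm (λ s j → 𝟙 (A i j Fin.≟ s)) ⟩
      ∑[ j < c ] ∑[ s < v ] 𝟙 (A i j Fin.≟ s)          ≡⟨ sum-cong-≗ (each-cell-one-symbol i) ⟩
      ∑[ j < c ] 1                                     ≡⟨ trans (∑-const c 1) (ℕ.*-identityʳ c) ⟩
      c                                                ∎

    ∑col≡r : ∀ j → ∑[ s < v ] col j s ≡ r
    ∑col≡r j = begin
      ∑[ s < v ] col j s                               ≡⟨ sum-cong-≗ (λ s → occurrences-in-col j s) ⟨
      ∑[ s < v ] count (λ i → A i j Fin.≟ s)           ≡⟨ sum-cong-≗ (λ s → count≡∑𝟙 (λ i → A i j Fin.≟ s)) ⟩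
      ∑[ s < v ] ∑[ i < r ] 𝟙 (A i j Fin.≟ s)          ≡⟨ ∑-comm (λ s i → 𝟙 (A i j Fin.≟ s)) ⟩
      ∑[ i < r ] ∑[ s < v ] 𝟙 (A i j Fin.≟ s)          ≡⟨ sum-cong-≗ (λ i → each-cell-one-symbol i j) ⟩
      ∑[ i < r ] 1                                     ≡⟨ trans (∑-const r 1) (ℕ.*-identityʳ r) ⟩
      r                                                ∎

    ∑-replication : ∑[ s < v ] replication A s ≡ r * c
    ∑-replication = begin
      ∑[ s < v ] replication A s       ≡⟨ sum-cong-≗ replication≡∑row ⟩
      ∑[ s < v ] ∑[ i < r ] row i s    ≡⟨ ∑-comm (λ s i → row i s) ⟩
      ∑[ i < r ] ∑[ s < v ] row i s    ≡⟨ sum-cong-≗ ∑row≡c ⟩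
      ∑[ i < r ] c                     ≡⟨ ∑-const r c ⟩
      r * c                            ∎

    ∑∑-rc : ∑[ i < r ] ∑[ j < c ] meet row col i j ≡ T
    ∑∑-rc = trans (∑∑-meet row col)
      (sum-cong-≗ λ s → sym (cong₂ _*_ (replication≡∑row s) (replication≡∑col s)))

    ∑∑-rr : ∑[ i < r ] ∑[ i′ < r ] meet row row i i′ ≡ T
    ∑∑-rr = trans (∑∑-meet row row)
      (sum-cong-≗ λ s → sym (cong₂ _*_ (replication≡∑row s) (replication≡∑row s)))

    ∑∑-cc : ∑[ j < c ] ∑[ j′ < c ] meet col col j j′ ≡ T
    ∑∑-cc = trans (∑∑-meet col col)
      (sum-cong-≗ λ s → sym (cong₂ _*_ (replication≡∑col s) (replication≡∑col s)))

    rr-diagonal : ∀ i → meet row row i i ≡ c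
    rr-diagonal i = trans (sum-cong-≗ λ s → 𝟙-idem (inRow? A i s)) (∑row≡c i)

    cc-diagonal : ∀ j → meet col col j j ≡ r
    cc-diagonal j = trans (sum-cong-≗ λ s → 𝟙-idem (inCol? A j s)) (∑col≡r j)

    concurrence-diagonal : ∀ s → concurrence s s ≡ replication A s + replication A s
    concurrence-diagonal s = cong₂ _+_
      (trans (sum-cong-≗ λ i → 𝟙-idem (inRow? A i s)) (sym (replication≡∑row s)))
      (trans (sum-cong-≗ λ j → 𝟙-idem (inCol? A j s)) (sym (replication≡∑col s)))

    ∑∑-concurrence : ∑[ s < v ] ∑[ t < v ] concurrence s t ≡ r * (c * c) + c * (r * r)
    ∑∑-concurrence = begin
      ∑[ s < v ] ∑[ t < v ] concurrence s t
        ≡⟨ ∑∑-distrib-+ (meet (transpose row) (transpose row)) (meet (transpose col) (transpose col)) ⟩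
      ∑[ s < v ] ∑[ t < v ] meet (transpose row) (transpose row) s t
        + ∑[ s < v ] ∑[ t < v ] meet (transpose col) (transpose col) s t
        ≡⟨ cong₂ _+_ (∑∑-meet (transpose row) (transpose row)) (∑∑-meet (transpose col) (transpose col)) ⟩
      ∑[ i < r ] (∑[ s < v ] row i s * ∑[ t < v ] row i t) + ∑[ j < c ] (∑[ s < v ] col j s * ∑[ t < v ] col j t)
        ≡⟨ cong₂ _+_ (sum-cong-≗ λ i → cong₂ _*_ (∑row≡c i) (∑row≡c i))
                     (sum-cong-≗ λ j → cong₂ _*_ (∑col≡r j) (∑col≡r j)) ⟩
      ∑[ i < r ] (c * c) + ∑[ j < c ] (r * r)
        ≡⟨ cong₂ _+_ (∑-const r (c * c)) (∑-const c (r * r)) ⟩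
      r * (c * c) + c * (r * r)
        ∎

    ∑∑-concurrence² : ∑[ s < v ] ∑[ t < v ] (concurrence s t * concurrence s t)
      ≡ ∑[ i < r ] ∑[ i′ < r ] (meet row row i i′ * meet row row i i′)
        + 2 * ∑[ i < r ] ∑[ j < c ] (meet row col i j * meet row col i j)
        + ∑[ j < c ] ∑[ j′ < c ] (meet col col j j′ * meet col col j j′)
    ∑∑-concurrence² =
      trans (∑∑-square-+ (meet (transpose row) (transpose row)) (meet (transpose col) (transpose col)))
            (cong₂ _+_ (cong₂ _+_ (∑∑-meet² row row) (cong (2 *_) (∑∑-meet² row col))) (∑∑-meet² col col))

    ∑-concurrence-row : ∀ s → ∑[ t < v ] concurrence s t ≡ replication A s * (c + r)
    ∑-concurrence-row s = begin
      ∑[ t < v ] concurrence s t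
        ≡⟨ ∑-distrib-+ (meet (transpose row) (transpose row) s) (meet (transpose col) (transpose col) s) ⟩
      ∑[ t < v ] ∑[ i < r ] (row i s * row i t) + ∑[ t < v ] ∑[ j < c ] (col j s * col j t)
        ≡⟨ cong₂ _+_ (∑-comm (λ t i → row i s * row i t)) (∑-comm (λ t j → col j s * col j t)) ⟩
      ∑[ i < r ] ∑[ t < v ] (row i s * row i t) + ∑[ j < c ] ∑[ t < v ] (col j s * col j t)
        ≡⟨ cong₂ _+_
             (sum-cong-≗ λ i → trans (sym (*-distribˡ-sum (row i s) (row i))) (cong (row i s *_) (∑row≡c i)))
             (sum-cong-≗ λ j → trans (sym (*-distribˡ-sum (col j s) (col j))) (cong (col j s *_) (∑col≡r j))) ⟩
      ∑[ i < r ] (row i s * c) + ∑[ j < c ] (col j s * r)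
        ≡⟨ cong₂ _+_ (sym (*-distribʳ-sum c (λ i → row i s))) (sym (*-distribʳ-sum r (λ j → col j s))) ⟩
      ∑[ i < r ] row i s * c + ∑[ j < c ] col j s * r
        ≡⟨ cong₂ _+_ (cong (_* c) (replication≡∑row s)) (cong (_* r) (replication≡∑col s)) ⟨
      replication A s * c + replication A s * r
        ≡⟨ ℕ.*-distribˡ-+ (replication A s) c r ⟨
      replication A s * (c + r)
        ∎

    balanced⇒equireplicate : 2 ℕ.≤ r → 2 ℕ.≤ c → ∀ {k} → (∀ s t → s ≢ t → concurrence s t ≡ k)
                           → ∀ s t → replication A s ≡ replication A t
    balanced⇒equireplicate 2≤r 2≤c {k} balanced s t =
      equal-row-sums⇒equal (c ∸ 2 + r) p≢0 (row-sum s) (row-sum t)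
      where
      p≢0 : c ∸ 2 + r ≢ 0
      p≢0 p≡0 = ≥2⇒≢0 2≤r (ℕ.m+n≡0⇒n≡0 (c ∸ 2) p≡0)
      row-sum : ∀ s → replication A s * (c ∸ 2 + r + 2) ≡ replication A s + replication A s + (v ∸ 1) * k
      row-sum s = begin
        replication A s * (c ∸ 2 + r + 2)            ≡⟨ cong (replication A s *_) c+r≡p+2 ⟨
        replication A s * (c + r)                    ≡⟨ ∑-concurrence-row s ⟨
        ∑[ t < v ] concurrence s t                   ≡⟨ ∑-off-constant (concurrence s) s (balanced s) ⟩
        concurrence s s + (v ∸ 1) * k                ≡⟨ cong (_+ (v ∸ 1) * k) (concurrence-diagonal s) ⟩
        replication A s + replication A s + (v ∸ 1) * k ∎
        where
        c+r≡p+2 : c + r ≡ c ∸ 2 + r + 2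
        c+r≡p+2 = trans (cong (_+ r) (sym (ℕ.m∸n+n≡m 2≤c))) (swap (c ∸ 2) r)
          where swap : ∀ x y → x + 2 + y ≡ x + y + 2
                swap = ℕ-solve-∀

    equireplicate⇒e-integral : Fin v → (∀ s t → replication A s ≡ replication A t) → IsInteger (e r c v)
    equireplicate⇒e-integral s₀ equireplicate = ℤ.+ replication A s₀ , ÷-unique (ℕ→ℚ-≢0 v≢0) (begin
      ℕ→ℚ (r * c)                        ≡⟨ cong ℕ→ℚ rc≡v*e₀ ⟩
      ℕ→ℚ (v * replication A s₀)         ≡⟨ trans (ℕ→ℚ-* v _) (ℚ.*-comm (ℕ→ℚ v) _) ⟩
      ℕ→ℚ (replication A s₀) ℚ.* ℕ→ℚ v   ∎)
      where
      rc≡v*e₀ : r * c ≡ v * replication A s₀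
      rc≡v*e₀ = trans (sym ∑-replication) (trans (sum-cong-≗ λ s → equireplicate s s₀) (∑-const v _))
      v≢0 : v ≢ 0
      v≢0 v≡0 = Fin.¬Fin0 (subst Fin v≡0 s₀)

    ∑≢-rr : Σrr + r * c ≡ T
    ∑≢-rr = ∑≢-complement (meet row row) (trans (sum-cong-≗ rr-diagonal) (∑-const r c)) ∑∑-rr

    ∑≢-cc : Σcc + r * c ≡ T
    ∑≢-cc = ∑≢-complement (meet col col) (trans (sum-cong-≗ cc-diagonal) (trans (∑-const c r) (ℕ.*-comm c r))) ∑∑-cc

    ∑≢-concurrence : Σconc + 2 * (r * c) ≡ r * (c * c) + c * (r * r)
    ∑≢-concurrence = ∑≢-complement concurrence diagonal ∑∑-concurrence
      where
      diagonal : ∑[ s < v ] concurrence s s ≡ 2 * (r * c)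
      diagonal = begin
        ∑[ s < v ] concurrence s s                                   ≡⟨ sum-cong-≗ concurrence-diagonal ⟩
        ∑[ s < v ] (replication A s + replication A s)               ≡⟨ ∑-distrib-+ (replication A) (replication A) ⟩
        ∑[ s < v ] replication A s + ∑[ s < v ] replication A s      ≡⟨ cong₂ _+_ ∑-replication ∑-replication ⟩
        r * c + r * c                                                ≡⟨ cong (r * c +_) (ℕ.+-identityʳ (r * c)) ⟨
        2 * (r * c)                                                  ∎

    ∑≢-concurrence² : Σconc² + 4 * T ≡ (Σrr² + r * (c * c)) + 2 * Σrc² + (Σcc² + c * (r * r))
    ∑≢-concurrence² = ∑≢-complement (λ s t → concurrence s t * concurrence s t) diagonal
      (trans ∑∑-concurrence² (cong₂ (λ x y → x + 2 * Σrc² + y)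
        (sym (∑≢-complement (λ i i′ → meet row row i i′ * meet row row i i′) rr-diagonal² refl))
        (sym (∑≢-complement (λ j j′ → meet col col j j′ * meet col col j j′) cc-diagonal² refl))))
      where
      four-squares : ∀ x → (x + x) * (x + x) ≡ 4 * (x * x)
      four-squares = ℕ-solve-∀
      diagonal : ∑[ s < v ] (concurrence s s * concurrence s s) ≡ 4 * T
      diagonal = begin
        ∑[ s < v ] (concurrence s s * concurrence s s)
          ≡⟨ sum-cong-≗ (λ s → cong₂ _*_ (concurrence-diagonal s) (concurrence-diagonal s)) ⟩
        ∑[ s < v ] ((replication A s + replication A s) * (replication A s + replication A s))
          ≡⟨ sum-cong-≗ (λ s → four-squares (replication A s)) ⟩
        ∑[ s < v ] (4 * (replication A s * replication A s))
          ≡⟨ *-distribˡ-sum 4 (λ s → replication A s * replication A s) ⟨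
        4 * T
          ∎
      rr-diagonal² : ∑[ i < r ] (meet row row i i * meet row row i i) ≡ r * (c * c)
      rr-diagonal² = trans (sum-cong-≗ λ i → cong₂ _*_ (rr-diagonal i) (rr-diagonal i)) (∑-const r (c * c))
      cc-diagonal² : ∑[ j < c ] (meet col col j j * meet col col j j) ≡ c * (r * r)
      cc-diagonal² = trans (sum-cong-≗ λ j → cong₂ _*_ (cc-diagonal j) (cc-diagonal j)) (∑-const c (r * r))

    -- The double-counting identity of the header, with the subtractions moved across.
    pair-excess : Σconc² + (Σrr + Σcc + 2 * Σrc) ≡ Σrr² + Σcc² + 2 * Σrc² + Σconc
    pair-excess = arithmetic Σconc² Σrr² Σcc² Σrc² Σconc Σrr Σcc Σrc (r * c) (r * (c * c)) (c * (r * r))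
      ∑≢-rr ∑≢-cc ∑∑-rc ∑≢-concurrence ∑≢-concurrence²
      where
      arithmetic : ∀ q qr qc qrc x xr xc xrc rc A B {T}
        → xr + rc ≡ T → xc + rc ≡ T → xrc ≡ T → x + 2 * rc ≡ A + B
        → q + 4 * T ≡ (qr + A) + 2 * qrc + (qc + B)
        → q + (xr + xc + 2 * xrc) ≡ qr + qc + 2 * qrc + x
      arithmetic q qr qc qrc x xr xc _ rc A B refl xc+rc≡xr+rc refl x+2rc≡A+B squares =
        ℕ.+-cancelʳ-≡ (2 * rc) _ _ (begin
          q + (xr + xc + 2 * (xr + rc)) + 2 * rc   ≡⟨ ℕ-solve (q ∷ xr ∷ xc ∷ rc ∷ []) ⟩
          q + 3 * (xr + rc) + (xc + rc)            ≡⟨ cong (q + 3 * (xr + rc) +_) xc+rc≡xr+rc ⟩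
          q + 3 * (xr + rc) + (xr + rc)            ≡⟨ ℕ-solve (q ∷ xr ∷ rc ∷ []) ⟩
          q + 4 * (xr + rc)                        ≡⟨ squares ⟩
          (qr + A) + 2 * qrc + (qc + B)            ≡⟨ ℕ-solve (qr ∷ A ∷ qrc ∷ qc ∷ B ∷ []) ⟩
          qr + qc + 2 * qrc + (A + B)              ≡⟨ cong (qr + qc + 2 * qrc +_) x+2rc≡A+B ⟨
          qr + qc + 2 * qrc + (x + 2 * rc)         ≡⟨ ℕ-solve (qr ∷ qc ∷ qrc ∷ x ∷ rc ∷ []) ⟩
          qr + qc + 2 * qrc + x + 2 * rc           ∎)

-- Equality in the bound

module TightBound {r c v} (2≤r : 2 ℕ.≤ r) (2≤c : 2 ℕ.≤ c) (2≤v : 2 ℕ.≤ v)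
                  (A : Design r c v) (binary : Binary A)
                  (replication-near : ∀ s → FloorOrCeil A (replication A s) (e r c v)) where
  open import Data.Nat using (_+_; _*_; _∸_)
  open Incidence A
  open Counting binary
  open ≡-Reasoning

  ch2v≢0 : ch2 v ≢ 0
  ch2v≢0 ch2v≡0 = [ ≥2⇒≢0 2≤v , ≥2⇒pred≢0 2≤v ]′
    (ℕ.m*n≡0⇒m≡0∨n≡0 v (trans (sym (ch2*2 2≤v)) (cong (_* 2) ch2v≡0)))

  rc≢0 : r * c ≢ 0
  rc≢0 rc≡0 = [ ≥2⇒≢0 2≤r , ≥2⇒≢0 2≤c ]′ (ℕ.m*n≡0⇒m≡0∨n≡0 r rc≡0)

  moment-replication : ℕ→ℚ T ℚ.+ e r c v ⁻ ℚ.* e r c v ⁺ ℚ.* ℕ→ℚ v ≡ (e r c v ⁻ ℚ.+ e r c v ⁺) ℚ.* ℕ→ℚ (r * c)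
  moment-replication = subst (λ x → ℕ→ℚ T ℚ.+ e r c v ⁻ ℚ.* e r c v ⁺ ℚ.* ℕ→ℚ v ≡ (e r c v ⁻ ℚ.+ e r c v ⁺) ℚ.* ℕ→ℚ x)
    ∑-replication (floorCeil-moment (replication A) replication-near)

  λrc*rc≡T : λrc r c v ℚ.* ℕ→ℚ (r * c) ≡ ℕ→ℚ T
  λrc*rc≡T = begin
    (a ℚ.+ b ℚ.- (a ℚ.* b) ÷ e r c v) ℚ.* R     ≡⟨ distrib (a ℚ.+ b) ((a ℚ.* b) ÷ e r c v) R ⟩
    (a ℚ.+ b) ℚ.* R ℚ.- (a ℚ.* b) ÷ e r c v ℚ.* R
                                              ≡⟨ cong (λ x → (a ℚ.+ b) ℚ.* R ℚ.- x)
                                                      (÷-÷-cancel {a ℚ.* b} (ℕ→ℚ-≢0 rc≢0) (ℕ→ℚ-≢0 (≥2⇒≢0 2≤v))) ⟩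
    (a ℚ.+ b) ℚ.* R ℚ.- a ℚ.* b ℚ.* V         ≡⟨ cong (λ x → x ℚ.- a ℚ.* b ℚ.* V) moment-replication ⟨
    ℕ→ℚ T ℚ.+ a ℚ.* b ℚ.* V ℚ.- a ℚ.* b ℚ.* V  ≡⟨ cancel (ℕ→ℚ T) (a ℚ.* b ℚ.* V) ⟩
    ℕ→ℚ T                                     ∎
    where
    a b R V : ℚ
    a = e r c v ⁻
    b = e r c v ⁺
    R = ℕ→ℚ (r * c)
    V = ℕ→ℚ v
    distrib : ∀ x y z → (x ℚ.- y) ℚ.* z ≡ x ℚ.* z ℚ.- y ℚ.* z
    distrib = solve-∀ ℚ-ring
    cancel : ∀ x y → x ℚ.+ y ℚ.- y ≡ x
    cancel = solve-∀ ℚ-ring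

  avg-rc≡λrc : avg-rc A ≡ λrc r c v
  avg-rc≡λrc = begin
    avg-rc A                    ≡⟨ cong (λ x → ℕ→ℚ x ÷ ℕ→ℚ (r * c)) ∑rc∩≡T ⟩
    ℕ→ℚ T ÷ ℕ→ℚ (r * c)         ≡⟨ ÷-unique (ℕ→ℚ-≢0 rc≢0) (sym λrc*rc≡T) ⟩
    λrc r c v                   ∎
    where
    ∑rc∩≡T : sumFin (λ i → sumFin (rc∩ A i)) ≡ T
    ∑rc∩≡T = trans (sumFin-cong λ i → sumFin-cong (rc∩≡meet i)) (trans (sumFin²≡∑∑ (meet row col)) ∑∑-rc)

  ∑≢-rr≡λrr*pairs : ℕ→ℚ Σrr ≡ λrr r c v ℚ.* ℕ→ℚ (r * (r ∸ 1))
  ∑≢-rr≡λrr*pairs = begin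
    ℕ→ℚ Σrr
      ≡⟨ ℕ→ℚ-cancelʳ Σrr (r * c) ∑≢-rr ⟩
    ℕ→ℚ T ℚ.- ℕ→ℚ (r * c)
      ≡⟨ cong₂ ℚ._-_ (sym λrc*rc≡T) (ℕ→ℚ-* r c) ⟩
    λrc r c v ℚ.* ℕ→ℚ (r * c) ℚ.- ℕ→ℚ r ℚ.* ℕ→ℚ c
      ≡⟨ cong (λ x → λrc r c v ℚ.* x ℚ.- ℕ→ℚ r ℚ.* ℕ→ℚ c) (ℕ→ℚ-* r c) ⟩
    λrc r c v ℚ.* (ℕ→ℚ r ℚ.* ℕ→ℚ c) ℚ.- ℕ→ℚ r ℚ.* ℕ→ℚ c
      ≡⟨ *-rescale (λrr r c v) (ℕ→ℚ (r ∸ 1)) (ℕ→ℚ r) (ℕ→ℚ c) (λrc r c v) (÷-*-cancel (ℕ→ℚ-≢0 (≥2⇒pred≢0 2≤r))) ⟨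
    λrr r c v ℚ.* (ℕ→ℚ r ℚ.* ℕ→ℚ (r ∸ 1))
      ≡⟨ cong (λrr r c v ℚ.*_) (ℕ→ℚ-* r (r ∸ 1)) ⟨
    λrr r c v ℚ.* ℕ→ℚ (r * (r ∸ 1))
      ∎

  ∑≢-cc≡λcc*pairs : ℕ→ℚ Σcc ≡ λcc r c v ℚ.* ℕ→ℚ (c * (c ∸ 1))
  ∑≢-cc≡λcc*pairs = begin
    ℕ→ℚ Σcc
      ≡⟨ ℕ→ℚ-cancelʳ Σcc (r * c) ∑≢-cc ⟩
    ℕ→ℚ T ℚ.- ℕ→ℚ (r * c)
      ≡⟨ cong₂ ℚ._-_ (sym λrc*rc≡T) (trans (cong ℕ→ℚ (ℕ.*-comm r c)) (ℕ→ℚ-* c r)) ⟩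
    λrc r c v ℚ.* ℕ→ℚ (r * c) ℚ.- ℕ→ℚ c ℚ.* ℕ→ℚ r
      ≡⟨ cong (λ x → λrc r c v ℚ.* x ℚ.- ℕ→ℚ c ℚ.* ℕ→ℚ r) (trans (cong ℕ→ℚ (ℕ.*-comm r c)) (ℕ→ℚ-* c r)) ⟩
    λrc r c v ℚ.* (ℕ→ℚ c ℚ.* ℕ→ℚ r) ℚ.- ℕ→ℚ c ℚ.* ℕ→ℚ r
      ≡⟨ *-rescale (λcc r c v) (ℕ→ℚ (c ∸ 1)) (ℕ→ℚ c) (ℕ→ℚ r) (λrc r c v) (÷-*-cancel (ℕ→ℚ-≢0 (≥2⇒pred≢0 2≤c))) ⟨
    λcc r c v ℚ.* (ℕ→ℚ c ℚ.* ℕ→ℚ (c ∸ 1))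
      ≡⟨ cong (λcc r c v ℚ.*_) (ℕ→ℚ-* c (c ∸ 1)) ⟨
    λcc r c v ℚ.* ℕ→ℚ (c * (c ∸ 1))
      ∎

  avg-rr≡λrr : avg-rr A ≡ λrr r c v
  avg-rr≡λrr = begin
    avg-rr A                                        ≡⟨ cong (λ x → ℕ→ℚ x ÷ ℕ→ℚ (r * (r ∸ 1)))
                                                         (trans (sumDistinct≡∑≢ A (rr∩ A)) (∑≢-cong rr∩≡meet)) ⟩
    ℕ→ℚ Σrr ÷ ℕ→ℚ (r * (r ∸ 1))                     ≡⟨ ÷-unique (ℕ→ℚ-≢0 rr≢0) ∑≢-rr≡λrr*pairs ⟩
    λrr r c v                                       ∎
    where
    rr≢0 : r * (r ∸ 1) ≢ 0
    rr≢0 eq = [ ≥2⇒≢0 2≤r , ≥2⇒pred≢0 2≤r ]′ (ℕ.m*n≡0⇒m≡0∨n≡0 r eq)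

  avg-cc≡λcc : avg-cc A ≡ λcc r c v
  avg-cc≡λcc = begin
    avg-cc A                                        ≡⟨ cong (λ x → ℕ→ℚ x ÷ ℕ→ℚ (c * (c ∸ 1)))
                                                         (trans (sumDistinct≡∑≢ A (cc∩ A)) (∑≢-cong cc∩≡meet)) ⟩
    ℕ→ℚ Σcc ÷ ℕ→ℚ (c * (c ∸ 1))                     ≡⟨ ÷-unique (ℕ→ℚ-≢0 cc≢0) ∑≢-cc≡λcc*pairs ⟩
    λcc r c v                                       ∎
    where
    cc≢0 : c * (c ∸ 1) ≢ 0
    cc≢0 eq = [ ≥2⇒≢0 2≤c , ≥2⇒pred≢0 2≤c ]′ (ℕ.m*n≡0⇒m≡0∨n≡0 c eq)

  pair-excessℚ : ℕ→ℚ Σconc² ℚ.+ (ℕ→ℚ Σrr ℚ.+ ℕ→ℚ Σcc ℚ.+ ℕ→ℚ 2 ℚ.* ℕ→ℚ Σrc)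
               ≡ ℕ→ℚ Σrr² ℚ.+ ℕ→ℚ Σcc² ℚ.+ ℕ→ℚ 2 ℚ.* ℕ→ℚ Σrc² ℚ.+ ℕ→ℚ Σconc
  pair-excessℚ = begin
    ℕ→ℚ Σconc² ℚ.+ (ℕ→ℚ Σrr ℚ.+ ℕ→ℚ Σcc ℚ.+ ℕ→ℚ 2 ℚ.* ℕ→ℚ Σrc)
      ≡⟨ cong (ℕ→ℚ Σconc² ℚ.+_) (cong₂ ℚ._+_ (ℕ→ℚ-+ Σrr Σcc) (ℕ→ℚ-* 2 Σrc)) ⟨
    ℕ→ℚ Σconc² ℚ.+ (ℕ→ℚ (Σrr + Σcc) ℚ.+ ℕ→ℚ (2 * Σrc))
      ≡⟨ trans (ℕ→ℚ-+ Σconc² (Σrr + Σcc + 2 * Σrc)) (cong (ℕ→ℚ Σconc² ℚ.+_) (ℕ→ℚ-+ (Σrr + Σcc) (2 * Σrc))) ⟨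
    ℕ→ℚ (Σconc² + (Σrr + Σcc + 2 * Σrc))
      ≡⟨ cong ℕ→ℚ pair-excess ⟩
    ℕ→ℚ (Σrr² + Σcc² + 2 * Σrc² + Σconc)
      ≡⟨ trans (ℕ→ℚ-+ (Σrr² + Σcc² + 2 * Σrc²) Σconc) (cong (ℚ._+ ℕ→ℚ Σconc) (ℕ→ℚ-+ (Σrr² + Σcc²) (2 * Σrc²))) ⟩
    ℕ→ℚ (Σrr² + Σcc²) ℚ.+ ℕ→ℚ (2 * Σrc²) ℚ.+ ℕ→ℚ Σconc
      ≡⟨ cong (ℚ._+ ℕ→ℚ Σconc) (cong₂ ℚ._+_ (ℕ→ℚ-+ Σrr² Σcc²) (ℕ→ℚ-* 2 Σrc²)) ⟩
    ℕ→ℚ Σrr² ℚ.+ ℕ→ℚ Σcc² ℚ.+ ℕ→ℚ 2 ℚ.* ℕ→ℚ Σrc² ℚ.+ ℕ→ℚ Σconc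
      ∎

  module _ (rc-near : ∀ i j → FloorOrCeil A (rc∩ A i j) (avg-rc A))
           (rr-near : ∀ i i′ → i ≢ i′ → FloorOrCeil A (rr∩ A i i′) (avg-rr A))
           (cc-near : ∀ j j′ → j ≢ j′ → FloorOrCeil A (cc∩ A j j′) (avg-cc A)) where

    chord-rc : ℕ→ℚ Σrc² ℚ.- ℕ→ℚ Σrc ≡ ℕ→ℚ (r * c) ℚ.* chord (λrc r c v)
    chord-rc = moment⇒chord (ℕ→ℚ Σrc²) (ℕ→ℚ Σrc) (ℕ→ℚ (r * c)) (λrc r c v)
      (floorCeil-moment₂ (meet row col) near)
      (trans (cong ℕ→ℚ ∑∑-rc) (trans (sym λrc*rc≡T) (ℚ.*-comm (λrc r c v) (ℕ→ℚ (r * c)))))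
      where
      near : ∀ i j → FloorOrCeil A (meet row col i j) (λrc r c v)
      near i j = subst₂ (FloorOrCeil A) (rc∩≡meet i j) avg-rc≡λrc (rc-near i j)

    chord-rr : ℕ→ℚ Σrr² ℚ.- ℕ→ℚ Σrr ≡ ℕ→ℚ (r * (r ∸ 1)) ℚ.* chord (λrr r c v)
    chord-rr = moment⇒chord (ℕ→ℚ Σrr²) (ℕ→ℚ Σrr) (ℕ→ℚ (r * (r ∸ 1))) (λrr r c v)
      (floorCeil-moment≢ (meet row row) near)
      (trans ∑≢-rr≡λrr*pairs (ℚ.*-comm (λrr r c v) (ℕ→ℚ (r * (r ∸ 1)))))
      where
      near : ∀ i i′ → i ≢ i′ → FloorOrCeil A (meet row row i i′) (λrr r c v)
      near i i′ i≢i′ = subst₂ (FloorOrCeil A) (rr∩≡meet i i′) avg-rr≡λrr (rr-near i i′ i≢i′)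

    chord-cc : ℕ→ℚ Σcc² ℚ.- ℕ→ℚ Σcc ≡ ℕ→ℚ (c * (c ∸ 1)) ℚ.* chord (λcc r c v)
    chord-cc = moment⇒chord (ℕ→ℚ Σcc²) (ℕ→ℚ Σcc) (ℕ→ℚ (c * (c ∸ 1))) (λcc r c v)
      (floorCeil-moment≢ (meet col col) near)
      (trans ∑≢-cc≡λcc*pairs (ℚ.*-comm (λcc r c v) (ℕ→ℚ (c * (c ∸ 1)))))
      where
      near : ∀ j j′ → j ≢ j′ → FloorOrCeil A (meet col col j j′) (λcc r c v)
      near j j′ j≢j′ = subst₂ (FloorOrCeil A) (cc∩≡meet j j′) avg-cc≡λcc (cc-near j j′ j≢j′)

    S-NTA*4 : S-NTA r c v ℚ.* ℕ→ℚ 4 ≡ ℕ→ℚ Σconc² ℚ.- ℕ→ℚ Σconc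
    S-NTA*4 = begin
      (Scc ℚ.+ Srr ℚ.+ Src) ℚ.* ℕ→ℚ 4
        ≡⟨ distrib Scc Srr Src (ℕ→ℚ 4) ⟩
      Scc ℚ.* ℕ→ℚ 4 ℚ.+ Srr ℚ.* ℕ→ℚ 4 ℚ.+ Src ℚ.* ℕ→ℚ 4
        ≡⟨ cong₂ ℚ._+_ (cong₂ ℚ._+_ (S-ch2*4 2≤c (λcc r c v)) (S-ch2*4 2≤r (λrr r c v))) (S*4 (r * c) (λrc r c v)) ⟩
      ℕ→ℚ (c * (c ∸ 1)) ℚ.* chord (λcc r c v) ℚ.+ ℕ→ℚ (r * (r ∸ 1)) ℚ.* chord (λrr r c v)
        ℚ.+ ℕ→ℚ 2 ℚ.* (ℕ→ℚ (r * c) ℚ.* chord (λrc r c v))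
        ≡⟨ cong₂ ℚ._+_ (cong₂ ℚ._+_ (sym chord-cc) (sym chord-rr)) (cong (ℕ→ℚ 2 ℚ.*_) (sym chord-rc)) ⟩
      (ℕ→ℚ Σcc² ℚ.- ℕ→ℚ Σcc) ℚ.+ (ℕ→ℚ Σrr² ℚ.- ℕ→ℚ Σrr) ℚ.+ ℕ→ℚ 2 ℚ.* (ℕ→ℚ Σrc² ℚ.- ℕ→ℚ Σrc)
        ≡⟨ regroup (ℕ→ℚ Σcc²) (ℕ→ℚ Σcc) (ℕ→ℚ Σrr²) (ℕ→ℚ Σrr) (ℕ→ℚ Σrc²) (ℕ→ℚ Σrc) (ℕ→ℚ Σconc) ⟩
      (ℕ→ℚ Σrr² ℚ.+ ℕ→ℚ Σcc² ℚ.+ ℕ→ℚ 2 ℚ.* ℕ→ℚ Σrc² ℚ.+ ℕ→ℚ Σconc)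
        ℚ.- (ℕ→ℚ Σrr ℚ.+ ℕ→ℚ Σcc ℚ.+ ℕ→ℚ 2 ℚ.* ℕ→ℚ Σrc) ℚ.- ℕ→ℚ Σconc
        ≡⟨ cong (λ x → x ℚ.- (ℕ→ℚ Σrr ℚ.+ ℕ→ℚ Σcc ℚ.+ ℕ→ℚ 2 ℚ.* ℕ→ℚ Σrc) ℚ.- ℕ→ℚ Σconc) pair-excessℚ ⟨
      (ℕ→ℚ Σconc² ℚ.+ (ℕ→ℚ Σrr ℚ.+ ℕ→ℚ Σcc ℚ.+ ℕ→ℚ 2 ℚ.* ℕ→ℚ Σrc))
        ℚ.- (ℕ→ℚ Σrr ℚ.+ ℕ→ℚ Σcc ℚ.+ ℕ→ℚ 2 ℚ.* ℕ→ℚ Σrc) ℚ.- ℕ→ℚ Σconc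
        ≡⟨ cancel (ℕ→ℚ Σconc²) (ℕ→ℚ Σrr ℚ.+ ℕ→ℚ Σcc ℚ.+ ℕ→ℚ 2 ℚ.* ℕ→ℚ Σrc) (ℕ→ℚ Σconc) ⟩
      ℕ→ℚ Σconc² ℚ.- ℕ→ℚ Σconc
        ∎
      where
      Scc Srr Src : ℚ
      Scc = S (ch2 c) (λcc r c v)
      Srr = S (ch2 r) (λrr r c v)
      Src = S (r * c) (λrc r c v)
      distrib : ∀ x y z w → (x ℚ.+ y ℚ.+ z) ℚ.* w ≡ x ℚ.* w ℚ.+ y ℚ.* w ℚ.+ z ℚ.* w
      distrib = solve-∀ ℚ-ring
      regroup : ∀ q a q′ a′ q″ a″ x
              → (q ℚ.- a) ℚ.+ (q′ ℚ.- a′) ℚ.+ ℕ→ℚ 2 ℚ.* (q″ ℚ.- a″)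
              ≡ (q′ ℚ.+ q ℚ.+ ℕ→ℚ 2 ℚ.* q″ ℚ.+ x) ℚ.- (a′ ℚ.+ a ℚ.+ ℕ→ℚ 2 ℚ.* a″) ℚ.- x
      regroup = solve-∀ ℚ-ring
      cancel : ∀ x y z → x ℚ.+ y ℚ.- y ℚ.- z ≡ x ℚ.- z
      cancel = solve-∀ ℚ-ring
    module _ (k : ℕ) (M≡k*ch2v : ch2 c * r + ch2 r * c ≡ k * ch2 v) where

      Σconc≡pairs*k : Σconc ≡ (v * (v ∸ 1)) * k
      Σconc≡pairs*k = begin
        Σconc                          ≡⟨ ℕ.+-cancelʳ-≡ (2 * (r * c)) Σconc _
                                            (trans ∑≢-concurrence (pairs-identity 2≤r 2≤c)) ⟩
        (ch2 c * r + ch2 r * c) * 2    ≡⟨ cong (_* 2) M≡k*ch2v ⟩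
        k * ch2 v * 2                  ≡⟨ ℕ.*-assoc k (ch2 v) 2 ⟩
        k * (ch2 v * 2)                ≡⟨ cong (k *_) (ch2*2 2≤v) ⟩
        k * (v * (v ∸ 1))              ≡⟨ ℕ.*-comm k _ ⟩
        v * (v ∸ 1) * k                ∎

      Σconc²≡pairs*k² : μ r c v ≡ ℕ→ℚ k → S-NTA r c v ≡ S-NBG r c v → Σconc² ≡ (v * (v ∸ 1)) * (k * k)
      Σconc²≡pairs*k² μ≡k tight = ℕ→ℚ-injective (begin
        ℕ→ℚ Σconc²
          ≡⟨ split (ℕ→ℚ Σconc²) (ℕ→ℚ Σconc) ⟩
        (ℕ→ℚ Σconc² ℚ.- ℕ→ℚ Σconc) ℚ.+ ℕ→ℚ Σconc
          ≡⟨ cong₂ ℚ._+_ excess (trans (cong ℕ→ℚ Σconc≡pairs*k) (ℕ→ℚ-* (v * (v ∸ 1)) k)) ⟩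
        N ℚ.* (K ℚ.* K ℚ.- K) ℚ.+ N ℚ.* K
          ≡⟨ collect N K ⟩
        N ℚ.* (K ℚ.* K)
          ≡⟨ trans (ℕ→ℚ-* (v * (v ∸ 1)) (k * k)) (cong (N ℚ.*_) (ℕ→ℚ-* k k)) ⟨
        ℕ→ℚ (v * (v ∸ 1) * (k * k))
          ∎)
        where
        N K : ℚ
        N = ℕ→ℚ (v * (v ∸ 1))
        K = ℕ→ℚ k
        split : ∀ x y → x ≡ (x ℚ.- y) ℚ.+ y
        split = solve-∀ ℚ-ring
        collect : ∀ n k → n ℚ.* (k ℚ.* k ℚ.- k) ℚ.+ n ℚ.* k ≡ n ℚ.* (k ℚ.* k)
        collect = solve-∀ ℚ-ring
        excess : ℕ→ℚ Σconc² ℚ.- ℕ→ℚ Σconc ≡ N ℚ.* (K ℚ.* K ℚ.- K)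
        excess = begin
          ℕ→ℚ Σconc² ℚ.- ℕ→ℚ Σconc       ≡⟨ S-NTA*4 ⟨
          S-NTA r c v ℚ.* ℕ→ℚ 4          ≡⟨ cong (ℚ._* ℕ→ℚ 4) tight ⟩
          S (ch2 v) (μ r c v) ℚ.* ℕ→ℚ 4   ≡⟨ S-ch2*4 2≤v (μ r c v) ⟩
          N ℚ.* chord (μ r c v)          ≡⟨ cong (λ m → N ℚ.* chord m) μ≡k ⟩
          N ℚ.* chord K                  ≡⟨ cong (N ℚ.*_) (chord-ℕ→ℚ k) ⟩
          N ℚ.* (K ℚ.* K ℚ.- K)          ∎

    tight⇒e-integral : IsInteger (μ r c v) → S-NTA r c v ≡ S-NBG r c v → IsInteger (e r c v)
    tight⇒e-integral μ-integral tight with integral-quotient ch2v≢0 μ-integral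
    ... | k , M≡k*ch2v , μ≡k = equireplicate⇒e-integral (fromℕ< 2≤v) (balanced⇒equireplicate 2≤r 2≤c balanced)
      where
      balanced : ∀ s t → s ≢ t → concurrence s t ≡ k
      balanced = constant-of-zero-variance≢ concurrence k
        (Σconc≡pairs*k k M≡k*ch2v) (Σconc²≡pairs*k² k M≡k*ch2v μ≡k tight)

corollary7p4 : (r c v : ℕ) → r ≥ 2 → c ≥ 2 → v ≥ 2
    → IsInteger (μ r c v)
    → ¬ IsInteger (e r c v)
    → S-NTA r c v ≡ S-NBG r c v
    → ¬ (Σ (Design r c v) IsNearTripleArray)
corollary7p4 r c v 2≤r 2≤c 2≤v μ-integral e-nonintegral tight (A , binary , inj₁ (e-integral , _) , _) =
  e-nonintegral e-integral
corollary7p4 r c v 2≤r 2≤c 2≤v μ-integral e-nonintegral tight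
             (A , binary , inj₂ (_ , replication-near) , rc-near , rr-near , cc-near) =
  e-nonintegral (TightBound.tight⇒e-integral 2≤r 2≤c 2≤v A binary replication-near rc-near rr-near cc-near
                                               μ-integral tight)
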